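{- Let $G$ be a finite, simple, connected unicyclic graph with unique cycle $C$, and let $S$ be a geodesic triple of vertices of $C$. Then any two distinct edges $e,f$ of $G$ that do not both belong to the same connected component of $G-E(C)$ (edges of $C$ belong to no such component) are distinguished by $S$, i.e. there is $s\in S$ with $d(e,s)\ne d(f,s)$.
   Context: A unicyclic graph is a connected graph containing exactly one cycle $C$; $d$ denotes graph distance, and for an edge $e=uv$ and vertex $s$, $d(e,s)=\min\{d(u,s),d(v,s)\}$. Three distinct vertices $v_i,v_j,v_k$ of $C$ form a geodesic triple if $d(v_i,v_j)+d(v_j,v_k)+d(v_i,v_k)=|V(C)|$; the set of these three vertices is then called a geodesic triple. -}

module Defs where

open import Data.Nat using (ℕ; zero; suc; _+_; _≤_; _⊓_)
open import Data.Fin using (Fin; toℕ)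
open import Data.Bool using (Bool; true)
open import Data.Product using (Σ; ∃; _×_; _,_)
open import Data.Sum using (_⊎_)
open import Relation.Binary.PropositionalEquality using (_≡_; _≢_)
open import Relation.Nullary using (¬_)

record Graph (n : ℕ) : Set where
  field
    adj   : Fin n → Fin n → Bool
    sym   : ∀ u v → adj u v ≡ true → adj v u ≡ true
    irrefl : ∀ u → ¬ (adj u u ≡ true)

open Graph public

Adj : ∀ {n} → Graph n → Fin n → Fin n → Set
Adj G u v = adj G u v ≡ true

data WalkIn {n : ℕ} (P : Fin n → Fin n → Set) : Fin n → Fin n → ℕ → Set where
  here : ∀ {u} → WalkIn P u u zero
  step : ∀ {u w v k} → P u w → WalkIn P w v k → WalkIn P u v (suc k)

Walk : ∀ {n} → Graph n → Fin n → Fin n → ℕ → Set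
Walk G = WalkIn (Adj G)

Connected : ∀ {n} → Graph n → Set
Connected G = ∀ u v → ∃ λ k → Walk G u v k

Dist : ∀ {n} → Graph n → Fin n → Fin n → ℕ → Set
Dist G u v k = Walk G u v k × (∀ j → Walk G u v j → k ≤ j)

EdgeDist : ∀ {n} → Graph n → Fin n → Fin n → Fin n → ℕ → Set
EdgeDist G u v s k = ∃ λ a → ∃ λ b → Dist G u s a × Dist G v s b × k ≡ a ⊓ b

CycSucc : (m : ℕ) → Fin m → Fin m → Set
CycSucc m i j = (toℕ j ≡ suc (toℕ i)) ⊎ ((suc (toℕ i) ≡ m) × (toℕ j ≡ zero))

record Cycle {n : ℕ} (G : Graph n) : Set where
  field
    len      : ℕ
    len≥3    : 3 ≤ len
    vert     : Fin len → Fin n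
    distinct : ∀ i j → vert i ≡ vert j → i ≡ j
    closed   : ∀ i j → CycSucc len i j → Adj G (vert i) (vert j)

open Cycle public

CycEdge : ∀ {n} {G : Graph n} → Cycle G → Fin n → Fin n → Set
CycEdge C u v = ∃ λ i → ∃ λ j → CycSucc (len C) i j ×
  ((vert C i ≡ u × vert C j ≡ v) ⊎ (vert C i ≡ v × vert C j ≡ u))

UnicyclicWith : ∀ {n} (G : Graph n) → Cycle G → Set
UnicyclicWith G C = Connected G ×
  (∀ (D : Cycle G) → ∀ u v → (CycEdge D u v → CycEdge C u v) × (CycEdge C u v → CycEdge D u v))

AdjOff : ∀ {n} {G : Graph n} → Cycle G → Fin n → Fin n → Set
AdjOff {G = G} C u v = Adj G u v × ¬ CycEdge C u v

SameComp : ∀ {n} {G : Graph n} → Cycle G → Fin n → Fin n → Fin n → Fin n → Set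
SameComp C u v x y = ¬ CycEdge C u v × ¬ CycEdge C x y × ∃ λ k → WalkIn (AdjOff C) u x k

SameEdge : ∀ {n} → Fin n → Fin n → Fin n → Fin n → Set
SameEdge u v x y = (u ≡ x × v ≡ y) ⊎ (u ≡ y × v ≡ x)

GeodesicTriple : ∀ {n} {G : Graph n} (C : Cycle G) → Fin (len C) → Fin (len C) → Fin (len C) → Set
GeodesicTriple {G = G} C i j k = i ≢ j × j ≢ k × i ≢ k ×
  ∃ λ a → ∃ λ b → ∃ λ c →
    Dist G (vert C i) (vert C j) a × Dist G (vert C j) (vert C k) b × Dist G (vert C i) (vert C k) c ×
    a + b + c ≡ len C

module Submission where

-- Write r(w) for the root of w, the unique vertex of C joined to w in G − E(C), and h(w) for the
-- length of that connection; then d(w, s) = h(w) + d_C(r(w), s) for every s on C. On the cycle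
-- doubled to length 2|C|, an edge e sits at a point X(e) (2r for an edge off C with root r, 2i + 1
-- for the cycle edge from i to i + 1), and 2 d(e, s) + [e ∈ C] = K(e) + d_2C(X(e), 2s) with K(e)
-- independent of s. A geodesic triple resolves a cycle even up to such additive constants: every
-- point lies on a geodesic between two of the three, which forces the constants to agree, and
-- equal distances to three points with pairwise distinct doubles force equal positions. Hence
-- edges not distinguished by S have the same point, so they coincide if they lie on C, share a
-- root (so lie in one component of G − E(C)) if they lie off C, and cannot be mixed by parity.

open import Defs hiding (sym)
open import Data.Bool using (true)
import Data.Bool.Properties as BoolP
open import Data.Empty using (⊥; ⊥-elim)
open import Data.Fin as Fin using (Fin; toℕ; fromℕ<)
import Data.Fin.Properties as FinP
open import Data.Integer as ℤ using (ℤ; +_; -[1+_]; ∣_∣; -_; 0ℤ)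
open import Data.Integer.DivMod using (_%ℕ_; _/ℕ_; n%ℕd<d; a≡a%ℕn+[a/ℕn]*n)
import Data.Integer.Properties as ℤP
open import Data.Integer.Tactic.RingSolver using (solve-∀)
open import Data.Nat as ℕ using (ℕ; zero; suc; _⊓_; _∸_; NonZero)
import Data.Nat.Properties as ℕP
import Data.Nat.Tactic.RingSolver as ℕSolver
open import Data.Product using (Σ; ∃; _×_; _,_; proj₁; proj₂)
open import Data.Sum using (_⊎_; inj₁; inj₂; [_,_]′)
open import Relation.Binary.Definitions using (tri<; tri≈; tri>)
open import Relation.Binary.PropositionalEquality
open import Relation.Nullary using (¬_; Dec; yes; no)
open import Relation.Nullary.Decidable using (_×-dec_; _⊎-dec_; ¬?)

[n∸m]+[o∸n]≡o∸m : ∀ {m n o} → m ℕ.≤ n → n ℕ.≤ o → (n ∸ m) ℕ.+ (o ∸ n) ≡ o ∸ m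
[n∸m]+[o∸n]≡o∸m {m} {n} {o} m≤n n≤o = ℕP.+-cancelʳ-≡ m _ _ (begin
    (n ∸ m) ℕ.+ (o ∸ n) ℕ.+ m  ≡⟨ swap (n ∸ m) (o ∸ n) m ⟩
    (n ∸ m) ℕ.+ m ℕ.+ (o ∸ n)  ≡⟨ cong (ℕ._+ (o ∸ n)) (ℕP.m∸n+n≡m m≤n) ⟩
    n ℕ.+ (o ∸ n)              ≡⟨ ℕP.m+[n∸m]≡n n≤o ⟩
    o                          ≡⟨ ℕP.m∸n+n≡m (ℕP.≤-trans m≤n n≤o) ⟨
    (o ∸ m) ℕ.+ m              ∎)
  where
  open ≡-Reasoning
  swap : ∀ a b c → a ℕ.+ b ℕ.+ c ≡ a ℕ.+ c ℕ.+ b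
  swap = ℕSolver.solve-∀

+-≤-tight₃ : ∀ {a a' b b' c c'} → a ℕ.≤ a' → b ℕ.≤ b' → c ℕ.≤ c' →
             a ℕ.+ b ℕ.+ c ≡ a' ℕ.+ b' ℕ.+ c' → (a ≡ a') × (b ≡ b') × (c ≡ c')
+-≤-tight₃ {a} {a'} {b} {b'} {c} {c'} p q r eq = a≡a' , b≡b' , c≡c'
  where
  c≡c' : c ≡ c'
  c≡c' = ℕP.≤-antisym r (ℕP.+-cancelˡ-≤ (a' ℕ.+ b') _ _
           (subst (ℕ._≤ (a' ℕ.+ b') ℕ.+ c) eq (ℕP.+-monoˡ-≤ c (ℕP.+-mono-≤ p q))))
  ab≡a'b' : a ℕ.+ b ≡ a' ℕ.+ b'
  ab≡a'b' = ℕP.+-cancelʳ-≡ c _ _ (trans eq (cong (a' ℕ.+ b' ℕ.+_) (sym c≡c')))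
  b≡b' : b ≡ b'
  b≡b' = ℕP.≤-antisym q (ℕP.+-cancelˡ-≤ a' _ _ (subst (ℕ._≤ a' ℕ.+ b) ab≡a'b' (ℕP.+-monoˡ-≤ b p)))
  a≡a' : a ≡ a'
  a≡a' = ℕP.+-cancelʳ-≡ b _ _ (trans ab≡a'b' (cong (a' ℕ.+_) (sym b≡b')))

∣i∣≡∣j∣⇒i≡j⊎i≡-j : ∀ i j → ∣ i ∣ ≡ ∣ j ∣ → (i ≡ j) ⊎ (i ≡ - j)
∣i∣≡∣j∣⇒i≡j⊎i≡-j (+ a) (+ b) eq = inj₁ (cong +_ eq)
∣i∣≡∣j∣⇒i≡j⊎i≡-j (+ a) -[1+ b ] eq = inj₂ (cong +_ eq)
∣i∣≡∣j∣⇒i≡j⊎i≡-j -[1+ a ] (+ b) eq = inj₂ (cong (λ n → - + n) eq)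
∣i∣≡∣j∣⇒i≡j⊎i≡-j -[1+ a ] -[1+ b ] eq = inj₁ (cong -[1+_] (ℕP.suc-injective eq))

even⊎odd : ∀ a → (Σ ℤ λ c → a ≡ c ℤ.* + 2) ⊎ (Σ ℤ λ c → a ≡ + 1 ℤ.+ c ℤ.* + 2)
even⊎odd a = from-remainder (a %ℕ 2) (n%ℕd<d a 2) (a≡a%ℕn+[a/ℕn]*n a 2)
  where
  from-remainder : ∀ r → r ℕ.< 2 → a ≡ + r ℤ.+ (a /ℕ 2) ℤ.* + 2 →
                   (Σ ℤ λ c → a ≡ c ℤ.* + 2) ⊎ (Σ ℤ λ c → a ≡ + 1 ℤ.+ c ℤ.* + 2)
  from-remainder 0 _ e = inj₁ (a /ℕ 2 , trans e (ℤP.+-identityˡ _))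
  from-remainder 1 _ e = inj₂ (a /ℕ 2 , e)
  from-remainder (suc (suc r)) (ℕ.s≤s (ℕ.s≤s ())) e

∣i+i∣≡∣i∣+∣i∣ : ∀ i → ∣ i ℤ.+ i ∣ ≡ ∣ i ∣ ℕ.+ ∣ i ∣
∣i+i∣≡∣i∣+∣i∣ i = trans (cong ∣_∣ (twice i)) (trans (ℤP.∣i*j∣≡∣i∣*∣j∣ (+ 2) i) (cong (∣ i ∣ ℕ.+_) (ℕP.+-identityʳ ∣ i ∣)))
  where
  twice : ∀ i → i ℤ.+ i ≡ + 2 ℤ.* i
  twice = solve-∀

-- Positions on a cycle of length M are integers modulo M.
module CyclicDistance (M : ℕ) {{_ : NonZero M}} where

  open import Data.Integer using (_+_; _*_; _-_)

  infix 4 _≋_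
  record _≋_ (x y : ℤ) : Set where
    constructor mk≋
    field
      multiple    : ℤ
      multiple-eq : x ≡ y + multiple * + M

  ≋-refl : ∀ {x} → x ≋ x
  ≋-refl {x} = mk≋ 0ℤ (x≡x+0m x (+ M))
    where
    x≡x+0m : ∀ x m → x ≡ x + 0ℤ * m
    x≡x+0m = solve-∀

  ≋-reflexive : ∀ {x y} → x ≡ y → x ≋ y
  ≋-reflexive refl = ≋-refl

  ≋-sym : ∀ {x y} → x ≋ y → y ≋ x
  ≋-sym {x} {y} (mk≋ c refl) = mk≋ (- c) (undo y c (+ M))
    where
    undo : ∀ y c m → y ≡ (y + c * m) + (- c) * m
    undo = solve-∀

  ≋-trans : ∀ {x y z} → x ≋ y → y ≋ z → x ≋ z
  ≋-trans {z = z} (mk≋ c refl) (mk≋ d refl) = mk≋ (c + d) (collect z c d (+ M))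
    where
    collect : ∀ z c d m → (z + d * m) + c * m ≡ z + (c + d) * m
    collect = solve-∀

  ≋-+ : ∀ {x y z w} → x ≋ y → z ≋ w → x + z ≋ y + w
  ≋-+ {y = y} {w = w} (mk≋ c refl) (mk≋ d refl) = mk≋ (c + d) (collect y w c d (+ M))
    where
    collect : ∀ y w c d m → (y + c * m) + (w + d * m) ≡ (y + w) + (c + d) * m
    collect = solve-∀

  ≋-resp : ∀ {a a' b b'} → a ≡ a' → b ≡ b' → a ≋ b → a' ≋ b'
  ≋-resp refl refl p = p

  ≋-cancelˡ : ∀ {x a b} → x + a ≋ x + b → a ≋ b
  ≋-cancelˡ {x} {a} {b} p = ≋-resp (cancel x a) (cancel x b) (≋-+ (≋-refl { - x}) p)
    where
    cancel : ∀ x a → (- x) + (x + a) ≡ a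
    cancel = solve-∀

  ≋-flip : ∀ {x y e} → y ≋ x + e → x ≋ y + (- e)
  ≋-flip {x} {y} {e} p = ≋-sym (≋-resp refl (move x e) (≋-+ p (≋-refl { - e})))
    where
    move : ∀ x e → (x + e) + (- e) ≡ x
    move = solve-∀

  ≋-+-trans : ∀ {x y z e₁ e₂} → y ≋ x + e₁ → z ≋ y + e₂ → z ≋ x + (e₁ + e₂)
  ≋-+-trans {x} {e₁ = e₁} {e₂} p q = ≋-trans q (≋-resp refl (ℤP.+-assoc x e₁ e₂) (≋-+ p (≋-refl {e₂})))

  M≋0 : + M ≋ 0ℤ
  M≋0 = mk≋ (+ 1) (trans (sym (ℤP.*-identityˡ (+ M))) (sym (ℤP.+-identityˡ _)))

  ≋-+M : ∀ {p} → p ≋ p + + M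
  ≋-+M {p} = ≋-resp (ℤP.+-identityʳ p) refl (≋-+ (≋-refl {p}) (≋-sym M≋0))

  +[M∸r]≡M-r : ∀ {r} → r ℕ.≤ M → + (M ∸ r) ≡ + M - + r
  +[M∸r]≡M-r {r} r≤M = sym (trans (ℤP.[+m]-[+n]≡m⊖n M r) (ℤP.⊖-≥ r≤M))

  opaque
    residue : ℤ → ℕ
    residue z = z %ℕ M

    residue<M : ∀ z → residue z ℕ.< M
    residue<M z = n%ℕd<d z M

    ≋-residue : ∀ z → z ≋ + residue z
    ≋-residue z = mk≋ (z /ℕ M) (a≡a%ℕn+[a/ℕn]*n z M)

  ≋⇒≡-below : ∀ {a b} → a ℕ.< M → b ℕ.< M → + a ≋ + b → a ≡ b
  ≋⇒≡-below {a} {b} a<M b<M (mk≋ c eq) = from-multiple c eq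
    where
    overflow : ∀ a b k → + a ≡ + b + (+ 1 + + k) * + M → ¬ (a ℕ.< M)
    overflow a b k eq a<M = ℕP.<⇒≱ a<M (subst (M ℕ.≤_) (sym a≡) (ℕP.≤-trans (ℕP.m≤m+n M (k ℕ.* M)) (ℕP.m≤n+m _ b)))
      where
      a≡ : a ≡ b ℕ.+ suc k ℕ.* M
      a≡ = ℤP.+-injective (trans eq (trans (cong (λ z → + b + z) (sym (ℤP.pos-* (suc k) M))) (sym (ℤP.pos-+ b (suc k ℕ.* M)))))
    negate : ∀ a b k → + a ≡ + b + (- (+ 1 + + k)) * + M → + b ≡ + a + (+ 1 + + k) * + M
    negate a b k eq = trans (sym (undo (+ b) (+ k) (+ M))) (cong (ℤ._+ (+ 1 + + k) * + M) (sym eq))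
      where
      undo : ∀ b k m → (b + (- (+ 1 + k)) * m) + (+ 1 + k) * m ≡ b
      undo = solve-∀
    from-multiple : ∀ c → + a ≡ + b + c * + M → a ≡ b
    from-multiple (+ zero) eq = ℤP.+-injective (trans eq (ℤP.+-identityʳ (+ b)))
    from-multiple (+ suc k) eq = ⊥-elim (overflow a b k eq a<M)
    from-multiple -[1+ k ] eq = ⊥-elim (overflow b a k (negate a b k eq) b<M)

  dist : ℤ → ℤ → ℕ
  dist x y = residue (y - x) ⊓ (M ∸ residue (y - x))

  ≋-+residue : ∀ x y → y ≋ x + + residue (y - x)
  ≋-+residue x y = ≋-resp (sym (x+[y-x]≡y x y)) refl (≋-+ (≋-refl {x}) (≋-residue (y - x)))
    where
    x+[y-x]≡y : ∀ x y → y ≡ x + (y - x)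
    x+[y-x]≡y = solve-∀

  dist-realised : ∀ x y → Σ ℤ λ e → (y ≋ x + e) × (∣ e ∣ ≡ dist x y)
  dist-realised x y = realise (r ℕ.≤? (M ∸ r))
    where
    r : ℕ
    r = residue (y - x)
    wrap : ∀ x r m → x + r ≡ (x + - (m - r)) + + 1 * m
    wrap = solve-∀
    backwards : x + + r ≋ x + - + (M ∸ r)
    backwards = mk≋ (+ 1) (trans (wrap x (+ r) (+ M))
                  (cong (λ z → (x + - z) + + 1 * + M) (sym (+[M∸r]≡M-r (ℕP.<⇒≤ (residue<M (y - x)))))))
    realise : Dec (r ℕ.≤ M ∸ r) → Σ ℤ λ e → (y ≋ x + e) × (∣ e ∣ ≡ dist x y)
    realise (yes r≤M∸r) = + r , ≋-+residue x y , sym (ℕP.m≤n⇒m⊓n≡m r≤M∸r)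
    realise (no r≰M∸r) = - + (M ∸ r) , ≋-trans (≋-+residue x y) backwards ,
      trans (ℤP.∣-i∣≡∣i∣ (+ (M ∸ r))) (sym (ℕP.m≥n⇒m⊓n≡n (ℕP.≰⇒≥ r≰M∸r)))

  private
    residue-offset-minimal : ∀ r c e → r ℕ.< M → e ≡ + r + c * + M → r ⊓ (M ∸ r) ℕ.≤ ∣ e ∣
    residue-offset-minimal r (+ j) e r<M refl =
      subst (r ⊓ (M ∸ r) ℕ.≤_) (cong ∣_∣ e≡) (ℕP.≤-trans (ℕP.m⊓n≤m r (M ∸ r)) (ℕP.m≤m+n r (j ℕ.* M)))
      where
      e≡ : + (r ℕ.+ j ℕ.* M) ≡ + r + + j * + M
      e≡ = trans (ℤP.pos-+ r (j ℕ.* M)) (cong (λ z → + r + z) (ℤP.pos-* j M))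
    residue-offset-minimal r -[1+ j ] e r<M refl =
      subst (r ⊓ (M ∸ r) ℕ.≤_) (sym ∣e∣≡) (ℕP.≤-trans (ℕP.m⊓n≤n r (M ∸ r)) (ℕP.m≤m+n (M ∸ r) (j ℕ.* M)))
      where
      K : ℕ
      K = (M ∸ r) ℕ.+ j ℕ.* M
      negated : ∀ R J m → R + (- (+ 1 + J)) * m ≡ - ((m - R) + J * m)
      negated = solve-∀
      e≡ : + r + -[1+ j ] * + M ≡ - + K
      e≡ = trans (negated (+ r) (+ j) (+ M))
             (cong -_ (sym (trans (ℤP.pos-+ (M ∸ r) (j ℕ.* M))
                             (cong₂ _+_ (+[M∸r]≡M-r (ℕP.<⇒≤ r<M)) (ℤP.pos-* j M)))))
      ∣e∣≡ : ∣ + r + -[1+ j ] * + M ∣ ≡ K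
      ∣e∣≡ = trans (cong ∣_∣ e≡) (ℤP.∣-i∣≡∣i∣ (+ K))

  dist-minimal : ∀ x y e → y ≋ x + e → dist x y ℕ.≤ ∣ e ∣
  dist-minimal x y e p = residue-offset-minimal (residue (y - x)) multiple e (residue<M (y - x)) multiple-eq
    where
    e≋r : e ≋ + residue (y - x)
    e≋r = ≋-cancelˡ {x} (≋-trans (≋-sym p) (≋-+residue x y))
    open _≋_ e≋r

  dist-sym : ∀ x y → dist x y ≡ dist y x
  dist-sym x y = ℕP.≤-antisym (dist-≤-reverse y x) (dist-≤-reverse x y)
    where
    dist-≤-reverse : ∀ x y → dist y x ℕ.≤ dist x y
    dist-≤-reverse x y with dist-realised x y
    ... | e , p , ∣e∣≡ = subst (dist y x ℕ.≤_) (trans (ℤP.∣-i∣≡∣i∣ e) ∣e∣≡) (dist-minimal y x (- e) (≋-flip p))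

  dist-triangle : ∀ x y z → dist x z ℕ.≤ dist x y ℕ.+ dist y z
  dist-triangle x y z with dist-realised x y | dist-realised y z
  ... | e₁ , p₁ , ∣e₁∣≡ | e₂ , p₂ , ∣e₂∣≡ =
    subst (dist x z ℕ.≤_) (cong₂ ℕ._+_ ∣e₁∣≡ ∣e₂∣≡)
      (ℕP.≤-trans (dist-minimal x z (e₁ + e₂) (≋-+-trans {x} {y} {z} {e₁} {e₂} p₁ p₂)) (ℤP.∣i+j∣≤∣i∣+∣j∣ e₁ e₂))

  dist-triangle′ : ∀ x y z → dist x z ℕ.≤ dist y x ℕ.+ dist y z
  dist-triangle′ x y z = subst (λ d → dist x z ℕ.≤ d ℕ.+ dist y z) (dist-sym x y) (dist-triangle x y z)

  dist-self : ∀ x → dist x x ≡ 0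
  dist-self x = ℕP.n≤0⇒n≡0 (dist-minimal x x 0ℤ (≋-resp refl (sym (ℤP.+-identityʳ x)) ≋-refl))

  Between : ℤ → ℤ → ℤ → Set
  Between a b x = dist x a ℕ.+ dist x b ≡ dist a b

  CoveredBy : ℤ → ℤ → ℤ → ℤ → Set
  CoveredBy p q r x = Between p q x ⊎ Between q r x ⊎ Between p r x

  ≋-difference : ∀ p {a b x y} → x ≋ p + + a → y ≋ p + + b → a ℕ.≤ b → y ≋ x + + (b ∸ a)
  ≋-difference p {a} {b} {x} px py a≤b =
    ≋-resp refl (cong (λ z → x + z) (sym +[b∸a]≡-a+b)) (≋-+-trans {x} {p} (≋-flip px) py)
    where
    +[b∸a]≡-a+b : + (b ∸ a) ≡ - + a + + b
    +[b∸a]≡-a+b = sym (trans (ℤP.-m+n≡n⊖m a b) (ℤP.⊖-≥ a≤b))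

  between-offsets : ∀ a b x t₁ t₂ → x ≋ a + + t₁ → b ≋ x + + t₂ → dist a b ≡ t₁ ℕ.+ t₂ → Between a b x
  between-offsets a b x t₁ t₂ ax xb dab = ℕP.≤-antisym
    (subst (dist x a ℕ.+ dist x b ℕ.≤_) (sym dab)
      (ℕP.+-mono-≤ (subst (ℕ._≤ t₁) (dist-sym a x) (dist-minimal a x (+ t₁) ax)) (dist-minimal x b (+ t₂) xb)))
    (dist-triangle′ a x b)

  -- With q, r, x at offsets u ≤ v and t from p, the three arcs of lengths u, v ∸ u and M ∸ v
  -- bound the pairwise distances and sum to M, so they are geodesics and x lies on one of them.
  covered-sorted : ∀ p q r x u v t → q ≋ p + + u → r ≋ p + + v → x ≋ p + + t → u ℕ.≤ v → v ℕ.≤ M → t ℕ.≤ M →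
                   dist p q ℕ.+ dist q r ℕ.+ dist p r ≡ M → CoveredBy p q r x
  covered-sorted p q r x u v t pq pr px u≤v v≤M t≤M sum = cover (t ℕ.≤? u) (t ℕ.≤? v)
    where
    dpq≤ : dist p q ℕ.≤ u
    dpq≤ = dist-minimal p q (+ u) pq
    dqr≤ : dist q r ℕ.≤ v ∸ u
    dqr≤ = dist-minimal q r _ (≋-difference p pq pr u≤v)
    dpr≤ : dist p r ℕ.≤ M ∸ v
    dpr≤ = subst (ℕ._≤ M ∸ v) (dist-sym r p) (dist-minimal r p _ (≋-difference p pr (≋-+M {p}) v≤M))
    arcs : u ℕ.+ (v ∸ u) ℕ.+ (M ∸ v) ≡ M
    arcs = trans (cong (ℕ._+ (M ∸ v)) (ℕP.m+[n∸m]≡n u≤v)) (ℕP.m+[n∸m]≡n v≤M)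
    geodesics : (dist p q ≡ u) × (dist q r ≡ v ∸ u) × (dist p r ≡ M ∸ v)
    geodesics = +-≤-tight₃ dpq≤ dqr≤ dpr≤ (trans sum (sym arcs))
    cover : Dec (t ℕ.≤ u) → Dec (t ℕ.≤ v) → CoveredBy p q r x
    cover (yes t≤u) _ = inj₁ (between-offsets p q x t (u ∸ t) px (≋-difference p px pq t≤u)
                          (trans (proj₁ geodesics) (sym (ℕP.m+[n∸m]≡n t≤u))))
    cover (no t≰u) (yes t≤v) = inj₂ (inj₁ (between-offsets q r x (t ∸ u) (v ∸ t)
                          (≋-difference p pq px u≤t) (≋-difference p px pr t≤v)
                          (trans (proj₁ (proj₂ geodesics)) (sym ([n∸m]+[o∸n]≡o∸m u≤t t≤v)))))
      where
      u≤t : u ℕ.≤ t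
      u≤t = ℕP.<⇒≤ (ℕP.≰⇒> t≰u)
    cover (no _) (no t≰v) = inj₂ (inj₂ (subst₂ _≡_ (ℕP.+-comm (dist x r) (dist x p)) (dist-sym r p)
                          (between-offsets r p x (t ∸ v) (M ∸ t) (≋-difference p pr px v≤t) (≋-difference p px (≋-+M {p}) t≤M)
                            (trans (trans (dist-sym r p) (proj₂ (proj₂ geodesics))) (sym ([n∸m]+[o∸n]≡o∸m v≤t t≤M))))))
      where
      v≤t : v ℕ.≤ t
      v≤t = ℕP.<⇒≤ (ℕP.≰⇒> t≰v)

  geodesic-triple-covers : ∀ p q r x → ¬ (q ≋ r) → dist p q ℕ.+ dist q r ℕ.+ dist p r ≡ M → CoveredBy p q r x
  geodesic-triple-covers p q r x q≉r sum with ℕP.<-cmp (residue (q - p)) (residue (r - p))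
  ... | tri< u<v _ _ = covered-sorted p q r x _ _ _ (≋-+residue p q) (≋-+residue p r) (≋-+residue p x)
                         (ℕP.<⇒≤ u<v) (ℕP.<⇒≤ (residue<M (r - p))) (ℕP.<⇒≤ (residue<M (x - p))) sum
  ... | tri≈ _ u≡v _ = ⊥-elim (q≉r (≋-trans (≋-+residue p q)
                         (≋-sym (subst (λ z → r ≋ p + + z) (sym u≡v) (≋-+residue p r)))))
  ... | tri> _ _ v<u = swap-q-r (covered-sorted p r q x _ _ _ (≋-+residue p r) (≋-+residue p q) (≋-+residue p x)
                         (ℕP.<⇒≤ v<u) (ℕP.<⇒≤ (residue<M (q - p))) (ℕP.<⇒≤ (residue<M (x - p))) sum′)
    where
    reorder : ∀ a b c → c ℕ.+ b ℕ.+ a ≡ a ℕ.+ b ℕ.+ c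
    reorder = ℕSolver.solve-∀
    sum′ : dist p r ℕ.+ dist r q ℕ.+ dist p q ≡ M
    sum′ = trans (cong (λ z → dist p r ℕ.+ z ℕ.+ dist p q) (dist-sym r q)) (trans (reorder (dist p q) (dist q r) (dist p r)) sum)
    swap-q-r : CoveredBy p r q x → CoveredBy p q r x
    swap-q-r (inj₁ b) = inj₂ (inj₂ b)
    swap-q-r (inj₂ (inj₁ b)) = inj₂ (inj₁ (subst₂ _≡_ (ℕP.+-comm (dist x r) (dist x q)) (dist-sym r q) b))
    swap-q-r (inj₂ (inj₂ b)) = inj₁ b

  private
    offset-≤ : ∀ {K₁ K₂ a a' b b' d} → K₁ ℕ.+ a ≡ K₂ ℕ.+ a' → K₁ ℕ.+ b ≡ K₂ ℕ.+ b' →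
               a ℕ.+ b ≡ d → d ℕ.≤ a' ℕ.+ b' → K₂ ℕ.≤ K₁
    offset-≤ {K₁} {K₂} {a} {a'} {b} {b'} ea eb refl d≤ with K₂ ℕ.≤? K₁
    ... | yes K₂≤K₁ = K₂≤K₁
    ... | no K₂≰K₁ = ⊥-elim (ℕP.<⇒≱ (ℕP.+-mono-< (shrinks ea) (shrinks eb)) d≤)
      where
      shrinks : ∀ {c c'} → K₁ ℕ.+ c ≡ K₂ ℕ.+ c' → c' ℕ.< c
      shrinks {c} {c'} e = ℕP.+-cancelˡ-< K₁ c' c
        (subst (K₁ ℕ.+ c' ℕ.<_) (sym e) (ℕP.+-monoˡ-< c' (ℕP.≰⇒> K₂≰K₁)))

  Offset : ℕ → ℤ → ℕ → ℤ → ℤ → Set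
  Offset K₁ x K₂ y s = K₁ ℕ.+ dist x s ≡ K₂ ℕ.+ dist y s

  -- Comparing at the two ends of a geodesic that x lies on, K₁ < K₂ would make y strictly closer to both.
  offset-≤-on-triple : ∀ p q r x y K₁ K₂ → ¬ (q ≋ r) → dist p q ℕ.+ dist q r ℕ.+ dist p r ≡ M →
                       Offset K₁ x K₂ y p → Offset K₁ x K₂ y q → Offset K₁ x K₂ y r → K₂ ℕ.≤ K₁
  offset-≤-on-triple p q r x y K₁ K₂ q≉r sum ep eq er with geodesic-triple-covers p q r x q≉r sum
  ... | inj₁ b = offset-≤ ep eq b (dist-triangle′ p y q)
  ... | inj₂ (inj₁ b) = offset-≤ eq er b (dist-triangle′ q y r)
  ... | inj₂ (inj₂ b) = offset-≤ ep er b (dist-triangle′ p y r)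

  equidistant⇒≋⊎reflected : ∀ s x y → dist x s ≡ dist y s → (x ≋ y) ⊎ (x + y ≋ s + s)
  equidistant⇒≋⊎reflected s x y d≡ = compare (dist-realised s x) (dist-realised s y)
    where
    reflect : ∀ s e → (s + (- e)) + (s + e) ≡ s + s
    reflect = solve-∀
    by-sign : ∀ {e₁ e₂} → x ≋ s + e₁ → y ≋ s + e₂ → (e₁ ≡ e₂) ⊎ (e₁ ≡ - e₂) → (x ≋ y) ⊎ (x + y ≋ s + s)
    by-sign sx sy (inj₁ refl) = inj₁ (≋-trans sx (≋-sym sy))
    by-sign {e₂ = e₂} sx sy (inj₂ refl) = inj₂ (≋-resp refl (reflect s e₂) (≋-+ sx sy))
    compare : (Σ ℤ λ e → (x ≋ s + e) × (∣ e ∣ ≡ dist s x)) → (Σ ℤ λ e → (y ≋ s + e) × (∣ e ∣ ≡ dist s y)) →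
              (x ≋ y) ⊎ (x + y ≋ s + s)
    compare (e₁ , sx , ∣e₁∣≡) (e₂ , sy , ∣e₂∣≡) = by-sign sx sy (∣i∣≡∣j∣⇒i≡j⊎i≡-j e₁ e₂
      (trans ∣e₁∣≡ (trans (dist-sym s x) (trans d≡ (trans (dist-sym y s) (sym ∣e₂∣≡))))))

  private
    ≋-of-doubles-even : ∀ p q c → p + p ≡ q + q + (c * + 2) * + M → p ≋ q
    ≋-of-doubles-even p q c e = mk≋ c (ℤP.*-cancelˡ-≡ (+ 2) p (q + c * + M) (trans (twice p) (trans e (sym (twice-shifted q c (+ M))))))
      where
      twice : ∀ p → + 2 * p ≡ p + p
      twice = solve-∀
      twice-shifted : ∀ q c m → + 2 * (q + c * m) ≡ q + q + (c * + 2) * m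
      twice-shifted = solve-∀

  -- Two odd multiples of M add up to an even one.
  ≋-of-doubles : ∀ p q r → p + p ≋ q + q → q + q ≋ r + r → (p ≋ q) ⊎ (q ≋ r) ⊎ (p ≋ r)
  ≋-of-doubles p q r (mk≋ a e₁) (mk≋ b e₂) = by-parity (even⊎odd a) (even⊎odd b)
    where
    odd+odd : ∀ r c c' m → (r + r + (+ 1 + c' * + 2) * m) + (+ 1 + c * + 2) * m ≡ r + r + ((+ 1 + c + c') * + 2) * m
    odd+odd = solve-∀
    by-parity : (Σ ℤ λ c → a ≡ c * + 2) ⊎ (Σ ℤ λ c → a ≡ + 1 + c * + 2) →
                (Σ ℤ λ c → b ≡ c * + 2) ⊎ (Σ ℤ λ c → b ≡ + 1 + c * + 2) → (p ≋ q) ⊎ (q ≋ r) ⊎ (p ≋ r)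
    by-parity (inj₁ (c , a≡)) _ = inj₁ (≋-of-doubles-even p q c (subst (λ z → p + p ≡ q + q + z * + M) a≡ e₁))
    by-parity (inj₂ _) (inj₁ (c , b≡)) = inj₂ (inj₁ (≋-of-doubles-even q r c (subst (λ z → q + q ≡ r + r + z * + M) b≡ e₂)))
    by-parity (inj₂ (c , a≡)) (inj₂ (c' , b≡)) = inj₂ (inj₂ (≋-of-doubles-even p r (+ 1 + c + c')
      (trans e₁ (trans (cong₂ (λ z w → z + w * + M) (trans e₂ (cong (λ z → r + r + z * + M) b≡)) a≡) (odd+odd r c c' (+ M))))))

  geodesic-triple-resolves : ∀ p q r x y K₁ K₂ → ¬ (p ≋ q) → ¬ (q ≋ r) → ¬ (p ≋ r) →
                             dist p q ℕ.+ dist q r ℕ.+ dist p r ≡ M →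
                             Offset K₁ x K₂ y p → Offset K₁ x K₂ y q → Offset K₁ x K₂ y r → x ≋ y
  geodesic-triple-resolves p q r x y K₁ K₂ p≉q q≉r p≉r sum ep eq er =
    conclude (reflection {p} ep) (reflection {q} eq) (reflection {r} er)
    where
    K₁≡K₂ : K₁ ≡ K₂
    K₁≡K₂ = ℕP.≤-antisym (offset-≤-on-triple p q r y x K₂ K₁ q≉r sum (sym ep) (sym eq) (sym er))
                         (offset-≤-on-triple p q r x y K₁ K₂ q≉r sum ep eq er)
    reflection : ∀ {s} → Offset K₁ x K₂ y s → (x ≋ y) ⊎ (x + y ≋ s + s)
    reflection {s} e = equidistant⇒≋⊎reflected s x y
      (ℕP.+-cancelˡ-≡ K₁ (dist x s) (dist y s) (trans e (cong (ℕ._+ dist y s) (sym K₁≡K₂))))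
    excluded : ∀ {A : Set} → (p ≋ q) ⊎ (q ≋ r) ⊎ (p ≋ r) → A
    excluded (inj₁ p≋q) = ⊥-elim (p≉q p≋q)
    excluded (inj₂ (inj₁ q≋r)) = ⊥-elim (q≉r q≋r)
    excluded (inj₂ (inj₂ p≋r)) = ⊥-elim (p≉r p≋r)
    conclude : (x ≋ y) ⊎ (x + y ≋ p + p) → (x ≋ y) ⊎ (x + y ≋ q + q) → (x ≋ y) ⊎ (x + y ≋ r + r) → x ≋ y
    conclude (inj₁ x≋y) _ _ = x≋y
    conclude _ (inj₁ x≋y) _ = x≋y
    conclude _ _ (inj₁ x≋y) = x≋y
    conclude (inj₂ hp) (inj₂ hq) (inj₂ hr) = excluded (≋-of-doubles p q r (≋-trans (≋-sym hp) hq) (≋-trans (≋-sym hq) hr))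

-- The cycle of length m is embedded in the cycle of length 2m: vertex i goes to 2i, and the
-- edge from i to i + 1 to its midpoint 2i + 1.
module Doubling (m : ℕ) {{_ : NonZero m}} where

  open import Data.Integer using (_+_; _*_; _-_)

  instance
    m+m-nonZero : NonZero (m ℕ.+ m)
    m+m-nonZero = ℕ.>-nonZero (ℕP.<-≤-trans (ℕ.>-nonZero⁻¹ m) (ℕP.m≤m+n m m))

  module A = CyclicDistance m
  module B = CyclicDistance (m ℕ.+ m)

  private
    B≋⇒≡ : ∀ {x y} → x B.≋ y → Σ ℤ λ c → x ≡ y + c * (+ m + + m)
    B≋⇒≡ {y = y} (B.mk≋ c e) = c , trans e (cong (λ z → y + c * z) (ℤP.pos-+ m m))

    ≡⇒B≋ : ∀ {x y} c → x ≡ y + c * (+ m + + m) → x B.≋ y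
    ≡⇒B≋ {y = y} c e = B.mk≋ c (trans e (cong (λ z → y + c * z) (sym (ℤP.pos-+ m m))))

    A≋-from-difference : ∀ x y c → y A.≋ x + (y - x - c * + m)
    A≋-from-difference x y c = A.mk≋ c (rearrange x y c (+ m))
      where
      rearrange : ∀ x y c m → y ≡ x + (y - x - c * m) + c * m
      rearrange = solve-∀

  dist-double : ∀ x y → B.dist (x + x) (y + y) ≡ A.dist x y ℕ.+ A.dist x y
  dist-double x y = ℕP.≤-antisym ≤double double≤
    where
    ≤double : B.dist (x + x) (y + y) ℕ.≤ A.dist x y ℕ.+ A.dist x y
    ≤double with A.dist-realised x y
    ... | e , A.mk≋ c refl , ∣e∣≡ = subst (B.dist (x + x) (y + y) ℕ.≤_) (trans (∣i+i∣≡∣i∣+∣i∣ e) (cong₂ ℕ._+_ ∣e∣≡ ∣e∣≡))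
          (B.dist-minimal (x + x) (y + y) (e + e) (≡⇒B≋ c (double x e c (+ m))))
      where
      double : ∀ x e c m → (x + e + c * m) + (x + e + c * m) ≡ (x + x) + (e + e) + c * (m + m)
      double = solve-∀
    double≤ : A.dist x y ℕ.+ A.dist x y ℕ.≤ B.dist (x + x) (y + y)
    double≤ with B.dist-realised (x + x) (y + y)
    ... | f , p , ∣f∣≡ with B≋⇒≡ p
    ... | c , eq = subst (A.dist x y ℕ.+ A.dist x y ℕ.≤_) (trans (sym (∣i+i∣≡∣i∣+∣i∣ g)) (trans (cong ∣_∣ (sym f≡g+g)) ∣f∣≡))
                     (ℕP.+-mono-≤ dist≤∣g∣ dist≤∣g∣)
      where
      g = y - x - c * + m
      halve : ∀ x f c m → ((x + x) + f + c * (m + m)) - (x + x) - c * (m + m) ≡ f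
      halve = solve-∀
      regroup : ∀ x y c m → (y + y) - (x + x) - c * (m + m) ≡ (y - x - c * m) + (y - x - c * m)
      regroup = solve-∀
      f≡g+g : f ≡ g + g
      f≡g+g = trans (sym (halve x f c (+ m))) (trans (cong (λ z → z - (x + x) - c * (+ m + + m)) (sym eq)) (regroup x y c (+ m)))
      dist≤∣g∣ : A.dist x y ℕ.≤ ∣ g ∣
      dist≤∣g∣ = A.dist-minimal x y g (A≋-from-difference x y c)

  private
    ∣2g-1∣-bound : ∀ g di dj → di ℕ.≤ ∣ g ∣ → dj ℕ.≤ ∣ - + 1 + g ∣ → suc ((di ⊓ dj) ℕ.+ (di ⊓ dj)) ℕ.≤ ∣ g + g - + 1 ∣
    ∣2g-1∣-bound (+ zero) di dj di≤ _ rewrite ℕP.n≤0⇒n≡0 (ℕP.≤-trans (ℕP.m⊓n≤m di dj) di≤) = ℕP.≤-refl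
    ∣2g-1∣-bound (+ suc n) di dj _ dj≤ = subst (suc (k ℕ.+ k) ℕ.≤_) (sym (ℕP.+-suc n n)) (ℕ.s≤s (ℕP.+-mono-≤ k≤n k≤n))
      where
      k : ℕ
      k = di ⊓ dj
      k≤n : k ℕ.≤ n
      k≤n = ℕP.≤-trans (ℕP.m⊓n≤n di dj) dj≤
    ∣2g-1∣-bound -[1+ n ] di dj di≤ _ = subst (suc (k ℕ.+ k) ℕ.≤_) (sym ∣2g-1∣≡) (ℕ.s≤s (ℕP.+-mono-≤ k≤1+n k≤1+n))
      where
      k : ℕ
      k = di ⊓ dj
      k≤1+n : k ℕ.≤ suc n
      k≤1+n = ℕP.≤-trans (ℕP.m⊓n≤m di dj) di≤
      ∣2g-1∣≡ : ∣ -[1+ n ] + -[1+ n ] - + 1 ∣ ≡ suc (suc n ℕ.+ suc n)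
      ∣2g-1∣≡ = cong (λ z → suc (suc z)) (trans (cong suc (ℕP.+-identityʳ (n ℕ.+ n))) (sym (ℕP.+-suc n n)))

  module _ (i j s : ℤ) (j≋i+1 : j A.≋ i + + 1) where

    private
      x : ℤ
      x = i + i + + 1
      di : ℕ
      di = A.dist i s
      dj : ℕ
      dj = A.dist j s

    dist-midpoint≤ : B.dist x (s + s) ℕ.≤ suc ((di ⊓ dj) ℕ.+ (di ⊓ dj))
    dist-midpoint≤ = ≤midpoint (ℕP.⊓-sel di dj)
      where
      via-i : B.dist x (s + s) ℕ.≤ suc (di ℕ.+ di)
      via-i with A.dist-realised i s
      ... | e , A.mk≋ c refl , ∣e∣≡ =
        ℕP.≤-trans (B.dist-minimal x (s + s) ((e + e) - + 1) (≡⇒B≋ c (double i e c (+ m))))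
          (subst (∣ (e + e) - + 1 ∣ ℕ.≤_) (cong suc (trans (∣i+i∣≡∣i∣+∣i∣ e) (cong₂ ℕ._+_ ∣e∣≡ ∣e∣≡)))
            (subst (∣ e + e - + 1 ∣ ℕ.≤_) (ℕP.+-comm ∣ e + e ∣ 1) (ℤP.∣i-j∣≤∣i∣+∣j∣ (e + e) (+ 1))))
        where
        double : ∀ i e c m → (i + e + c * m) + (i + e + c * m) ≡ (i + i + + 1) + ((e + e) - + 1) + c * (m + m)
        double = solve-∀
      via-j : B.dist x (s + s) ℕ.≤ suc (dj ℕ.+ dj)
      via-j with A.dist-realised j s
      ... | e , js , ∣e∣≡ with A.≋-+-trans {i} {j} {s} {+ 1} {e} j≋i+1 js
      ... | A.mk≋ c eq =
        ℕP.≤-trans (B.dist-minimal x (s + s) ((e + e) + + 1) (≡⇒B≋ c (trans (cong₂ _+_ eq eq) (double i e c (+ m)))))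
          (subst (∣ (e + e) + + 1 ∣ ℕ.≤_) (cong suc (trans (∣i+i∣≡∣i∣+∣i∣ e) (cong₂ ℕ._+_ ∣e∣≡ ∣e∣≡)))
            (subst (∣ e + e + + 1 ∣ ℕ.≤_) (ℕP.+-comm ∣ e + e ∣ 1) (ℤP.∣i+j∣≤∣i∣+∣j∣ (e + e) (+ 1))))
        where
        double : ∀ i e c m → (i + (+ 1 + e) + c * m) + (i + (+ 1 + e) + c * m) ≡ (i + i + + 1) + ((e + e) + + 1) + c * (m + m)
        double = solve-∀
      ≤midpoint : (di ⊓ dj ≡ di) ⊎ (di ⊓ dj ≡ dj) → B.dist x (s + s) ℕ.≤ suc ((di ⊓ dj) ℕ.+ (di ⊓ dj))
      ≤midpoint (inj₁ e) = subst (λ z → B.dist x (s + s) ℕ.≤ suc (z ℕ.+ z)) (sym e) via-i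
      ≤midpoint (inj₂ e) = subst (λ z → B.dist x (s + s) ℕ.≤ suc (z ℕ.+ z)) (sym e) via-j

    midpoint≤dist : suc ((di ⊓ dj) ℕ.+ (di ⊓ dj)) ℕ.≤ B.dist x (s + s)
    midpoint≤dist with B.dist-realised x (s + s)
    ... | f , p , ∣f∣≡ with B≋⇒≡ p
    ... | c , eq = subst (suc ((di ⊓ dj) ℕ.+ (di ⊓ dj)) ℕ.≤_) (trans (cong ∣_∣ (sym f≡2g-1)) ∣f∣≡)
                     (∣2g-1∣-bound g di dj (A.dist-minimal i s g si) (A.dist-minimal j s (- + 1 + g) sj))
      where
      g : ℤ
      g = s - i - c * + m
      unshift : ∀ i f c m → ((i + i + + 1) + f + c * (m + m)) - (i + i + + 1) - c * (m + m) ≡ f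
      unshift = solve-∀
      regroup : ∀ s i c m → (s + s) - (i + i + + 1) - c * (m + m) ≡ (s - i - c * m) + (s - i - c * m) - + 1
      regroup = solve-∀
      f≡2g-1 : f ≡ g + g - + 1
      f≡2g-1 = trans (sym (unshift i f c (+ m))) (trans (cong (λ z → z - x - c * (+ m + + m)) (sym eq)) (regroup s i c (+ m)))
      si : s A.≋ i + g
      si = A≋-from-difference i s c
      sj : s A.≋ j + (- + 1 + g)
      sj = A.≋-+-trans {j} {i} {s} { - + 1} {g} (A.≋-flip {i} {j} {+ 1} j≋i+1) si

    dist-midpoint : B.dist x (s + s) ≡ suc ((di ⊓ dj) ℕ.+ (di ⊓ dj))
    dist-midpoint = ℕP.≤-antisym dist-midpoint≤ midpoint≤dist

  private
    A≋-from-double : ∀ x y c → x + x ≡ y + y + c * (+ m + + m) → x A.≋ y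
    A≋-from-double x y c eq = A.mk≋ c (ℤP.*-cancelˡ-≡ (+ 2) x (y + c * + m) (trans (twice x) (trans eq (twice-shifted y c (+ m)))))
      where
      twice : ∀ x → + 2 * x ≡ x + x
      twice = solve-∀
      twice-shifted : ∀ y c m → y + y + c * (m + m) ≡ + 2 * (y + c * m)
      twice-shifted = solve-∀

  halve-≋ : ∀ x y → x + x B.≋ y + y → x A.≋ y
  halve-≋ x y p with B≋⇒≡ p
  ... | c , eq = A≋-from-double x y c eq

  halve-odd-≋ : ∀ x y → x + x + + 1 B.≋ y + y + + 1 → x A.≋ y
  halve-odd-≋ x y p with B≋⇒≡ p
  ... | c , eq = A≋-from-double x y c (trans (sym (drop-1 x)) (trans (cong (_+ - + 1) eq) (drop-1′ y c (+ m))))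
    where
    drop-1 : ∀ x → x + x + + 1 + - + 1 ≡ x + x
    drop-1 = solve-∀
    drop-1′ : ∀ y c m → y + y + + 1 + c * (m + m) + - + 1 ≡ y + y + c * (m + m)
    drop-1′ = solve-∀

  odd≉even : ∀ x y → ¬ (x + x + + 1 B.≋ y + y)
  odd≉even x y p with B≋⇒≡ p
  ... | c , eq = 1≢2k ∣ z ∣ (trans (cong ∣_∣ 1≡2z) (ℤP.∣i*j∣≡∣i∣*∣j∣ (+ 2) z))
    where
    z : ℤ
    z = y + c * + m - x
    cancel : ∀ x → x + x + + 1 + - (x + x) ≡ + 1
    cancel = solve-∀
    regroup : ∀ x y c m → y + y + c * (m + m) + - (x + x) ≡ + 2 * (y + c * m - x)
    regroup = solve-∀
    1≡2z : + 1 ≡ + 2 * z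
    1≡2z = trans (sym (cancel x)) (trans (cong (_+ - (x + x)) eq) (regroup x y c (+ m)))
    1≢2k : ∀ k → 1 ≢ 2 ℕ.* k
    1≢2k zero ()
    1≢2k (suc k) e = ℕP.1+n≢0 (sym (trans (ℕP.suc-injective e) (ℕP.+-suc k (k ℕ.+ 0))))

module _ {n : ℕ} {P : Fin n → Fin n → Set} where

  _++ʷ_ : ∀ {u v w k l} → WalkIn P u v k → WalkIn P v w l → WalkIn P u w (k ℕ.+ l)
  here ++ʷ q = q
  step p w ++ʷ q = step p (w ++ʷ q)

  snocʷ : ∀ {u v w k} → WalkIn P u v k → P v w → WalkIn P u w (suc k)
  snocʷ {k = k} w p = subst (WalkIn P _ _) (ℕP.+-comm k 1) (w ++ʷ step p here)

  reverseʷ : (∀ {a b} → P a b → P b a) → ∀ {u v k} → WalkIn P u v k → WalkIn P v u k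
  reverseʷ sym-P here = here
  reverseʷ sym-P (step p w) = snocʷ (reverseʷ sym-P w) (sym-P p)

  mapʷ : ∀ {Q : Fin n → Fin n → Set} → (∀ {a b} → P a b → Q a b) → ∀ {u v k} → WalkIn P u v k → WalkIn Q u v k
  mapʷ f here = here
  mapʷ f (step p w) = step (f p) (mapʷ f w)

module CycleIndexing {n} (G : Graph n) (C : Cycle G) where

  m : ℕ
  m = len C

  instance
    m-nonZero : NonZero m
    m-nonZero = ℕ.>-nonZero (ℕP.<-≤-trans (ℕ.s≤s ℕ.z≤n) (len≥3 C))

  module A = CyclicDistance m
  open A using (_≋_; ≋-refl; ≋-sym; ≋-trans; ≋-resp; residue<M; ≋-residue; ≋⇒≡-below)

  cv : Fin m → Fin n
  cv = vert C

  position : Fin m → ℤ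
  position t = + toℕ t

  position-injective : ∀ {s t} → position s ≋ position t → s ≡ t
  position-injective {s} {t} p = FinP.toℕ-injective (≋⇒≡-below (FinP.toℕ<n s) (FinP.toℕ<n t) p)

  index : ℕ → Fin m
  index k = fromℕ< (residue<M (+ k))

  cycVertex : ℕ → Fin n
  cycVertex k = cv (index k)

  index-≋ : ∀ k → position (index k) ≋ + k
  index-≋ k = ≋-resp (cong +_ (sym (FinP.toℕ-fromℕ< (residue<M (+ k))))) refl (≋-sym (≋-residue (+ k)))

  index-toℕ : ∀ t → index (toℕ t) ≡ t
  index-toℕ t = position-injective (index-≋ (toℕ t))

  cycVertex-toℕ : ∀ t → cycVertex (toℕ t) ≡ cv t
  cycVertex-toℕ t = cong cv (index-toℕ t)

  cycVertex-cong : ∀ {a b} → + a ≋ + b → cycVertex a ≡ cycVertex b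
  cycVertex-cong {a} {b} p = cong cv (position-injective (≋-trans (index-≋ a) (≋-trans p (≋-sym (index-≋ b)))))

  cycVertex-injective : ∀ {a b} → cycVertex a ≡ cycVertex b → + a ≋ + b
  cycVertex-injective {a} {b} e =
    ≋-trans (≋-sym (index-≋ a)) (≋-trans (A.≋-reflexive (cong position (distinct C _ _ e))) (index-≋ b))

  +suc≡++1 : ∀ k → + suc k ≡ + k ℤ.+ + 1
  +suc≡++1 k = trans (cong +_ (ℕP.+-comm 1 k)) (ℤP.pos-+ k 1)

  CycSucc⇒≋suc : ∀ {i j} → CycSucc m i j → position j ≋ position i ℤ.+ + 1
  CycSucc⇒≋suc {i} (inj₁ e) = ≋-resp (cong +_ (sym e)) (+suc≡++1 (toℕ i)) ≋-refl
  CycSucc⇒≋suc {i} (inj₂ (e₁ , e₂)) = ≋-resp (cong +_ (sym e₂)) (trans (cong +_ (sym e₁)) (+suc≡++1 (toℕ i))) (≋-sym A.M≋0)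

  CycSucc-index : ∀ a → CycSucc m (index a) (index (suc a))
  CycSucc-index a with suc (toℕ (index a)) ℕ.<? m
  ... | yes lt = inj₁ (≋⇒≡-below (FinP.toℕ<n (index (suc a))) lt (≋-trans (index-≋ (suc a)) next))
    where
    next : + suc a ≋ + suc (toℕ (index a))
    next = ≋-resp (sym (+suc≡++1 a)) (sym (+suc≡++1 _)) (A.≋-+ (≋-sym (index-≋ a)) (≋-refl {+ 1}))
  ... | no nlt = inj₂ (last , ≋⇒≡-below (FinP.toℕ<n (index (suc a))) (ℕ.>-nonZero⁻¹ m)
                   (≋-trans (index-≋ (suc a)) (≋-trans next A.M≋0)))
    where
    last : suc (toℕ (index a)) ≡ m
    last = ℕP.≤-antisym (FinP.toℕ<n (index a)) (ℕP.≮⇒≥ nlt)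
    next : + suc a ≋ + m
    next = ≋-resp (sym (+suc≡++1 a)) (trans (sym (+suc≡++1 _)) (cong +_ last)) (A.≋-+ (≋-sym (index-≋ a)) (≋-refl {+ 1}))

  cycVertex-adj : ∀ a → Adj G (cycVertex a) (cycVertex (suc a))
  cycVertex-adj a = closed C _ _ (CycSucc-index a)

  arc-walk : ∀ a k → Walk G (cycVertex a) (cycVertex (a ℕ.+ k)) k
  arc-walk a zero = subst (λ z → Walk G (cycVertex a) (cycVertex z) 0) (sym (ℕP.+-identityʳ a)) here
  arc-walk a (suc k) = step (cycVertex-adj a)
    (subst (λ z → Walk G (cycVertex (suc a)) (cycVertex z) k) (sym (ℕP.+-suc a k)) (arc-walk (suc a) k))

  CycSucc? : ∀ i j → Dec (CycSucc m i j)
  CycSucc? i j = (toℕ j ℕ.≟ suc (toℕ i)) ⊎-dec ((suc (toℕ i) ℕ.≟ m) ×-dec (toℕ j ℕ.≟ 0))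

  cycEdge? : ∀ u v → Dec (CycEdge C u v)
  cycEdge? u v = FinP.any? λ i → FinP.any? λ j → CycSucc? i j ×-dec
    (((cv i Fin.≟ u) ×-dec (cv j Fin.≟ v)) ⊎-dec ((cv i Fin.≟ v) ×-dec (cv j Fin.≟ u)))

  OnCycle : Fin n → Set
  OnCycle w = Σ (Fin m) λ t → cv t ≡ w

  onCycle? : ∀ w → Dec (OnCycle w)
  onCycle? w = FinP.any? λ t → cv t Fin.≟ w

  cycEdge-sym : ∀ {u v} → CycEdge C u v → CycEdge C v u
  cycEdge-sym (i , j , s , inj₁ (a , b)) = i , j , s , inj₂ (a , b)
  cycEdge-sym (i , j , s , inj₂ (a , b)) = i , j , s , inj₁ (a , b)

  cycEdge⇒onCycle : ∀ {u v} → CycEdge C u v → OnCycle u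
  cycEdge⇒onCycle (i , j , s , inj₁ (a , b)) = i , a
  cycEdge⇒onCycle (i , j , s , inj₂ (a , b)) = j , b

  adjOff-sym : ∀ {u v} → AdjOff C u v → AdjOff C v u
  adjOff-sym (a , nc) = Graph.sym G _ _ a , λ c → nc (cycEdge-sym c)

bounded-search : (Q : ℕ → Set) → (∀ k → Dec (Q k)) → ∀ N → (Σ ℕ λ k → k ℕ.< N × Q k) ⊎ (∀ k → k ℕ.< N → ¬ Q k)
bounded-search Q Q? N with FinP.any? (λ (k : Fin N) → Q? (toℕ k))
... | yes (k , q) = inj₁ (toℕ k , FinP.toℕ<n k , q)
... | no ¬q = inj₂ λ k k<N qk → ¬q (fromℕ< k<N , subst Q (sym (FinP.toℕ-fromℕ< k<N)) qk)

minimal-witness : (Q : ℕ → Set) → (∀ k → Dec (Q k)) → ∀ k₀ → Q k₀ → Σ ℕ λ k → Q k × (∀ j → j ℕ.< k → ¬ Q j)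
minimal-witness Q Q? k₀ q₀ = scan k₀ 0 (ℕP.+-identityʳ k₀) (λ _ ())
  where
  scan : ∀ fuel j → fuel ℕ.+ j ≡ k₀ → (∀ i → i ℕ.< j → ¬ Q i) → Σ ℕ λ k → Q k × (∀ i → i ℕ.< k → ¬ Q i)
  scan fuel j _ none-below with Q? j
  ... | yes q = j , q , none-below
  scan zero j refl _ | no ¬q = ⊥-elim (¬q q₀)
  scan (suc fuel) j e none-below | no ¬q = scan fuel (suc j) (trans (ℕP.+-suc fuel j) e) none-up-to-j
    where
    none-up-to-j : ∀ i → i ℕ.< suc j → ¬ Q i
    none-up-to-j i i<1+j with ℕP.m<1+n⇒m<n∨m≡n i<1+j
    ... | inj₁ i<j = none-below i i<j
    ... | inj₂ refl = ¬q

-- Walks as vertex sequences ℕ → Fin n: prefixes, suffixes, reversal and cutting out a closed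
-- subwalk become arithmetic on the index.
record FunWalk {n : ℕ} (P : Fin n → Fin n → Set) (u v : Fin n) (L : ℕ) : Set where
  constructor funWalk
  field
    at    : ℕ → Fin n
    at-0  : at 0 ≡ u
    at-L  : at L ≡ v
    steps : ∀ k → k ℕ.< L → P (at k) (at (suc k))

module _ {n : ℕ} {P : Fin n → Fin n → Set} where

  toFunWalk : ∀ {u v L} → WalkIn P u v L → FunWalk P u v L
  toFunWalk {u} here = funWalk (λ _ → u) refl refl (λ k ())
  toFunWalk {u} (step p w) with toFunWalk w
  ... | funWalk g g0 gL gsteps = funWalk (λ { zero → u ; (suc k) → g k }) refl gL steps
    where
    steps : ∀ k → k ℕ.< suc _ → P _ _
    steps zero _ = subst (P u) (sym g0) p
    steps (suc k) (ℕ.s≤s k<L) = gsteps k k<L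

  prefix : ∀ {u v L} (w : FunWalk P u v L) k → k ℕ.≤ L → FunWalk P u (FunWalk.at w k) k
  prefix (funWalk f f0 _ steps) k k≤L = funWalk f f0 refl (λ j j<k → steps j (ℕP.<-≤-trans j<k k≤L))

  suffix : ∀ {u v L} (w : FunWalk P u v L) k → k ℕ.≤ L → FunWalk P (FunWalk.at w k) v (L ∸ k)
  suffix (funWalk f _ fL steps) k k≤L = funWalk (λ j → f (k ℕ.+ j)) (cong f (ℕP.+-identityʳ k))
    (trans (cong f (ℕP.m+[n∸m]≡n k≤L)) fL)
    (λ j j<L∸k → subst (λ z → P (f (k ℕ.+ j)) (f z)) (sym (ℕP.+-suc k j))
       (steps (k ℕ.+ j) (subst (k ℕ.+ j ℕ.<_) (ℕP.m+[n∸m]≡n k≤L) (ℕP.+-monoʳ-< k j<L∸k))))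

  reverse : (∀ {a b} → P a b → P b a) → ∀ {u v L} → FunWalk P u v L → FunWalk P v u L
  reverse sym-P {L = L} (funWalk f f0 fL steps) = funWalk (λ j → f (L ∸ j)) fL (trans (cong f (ℕP.n∸n≡0 L)) f0)
    (λ j j<L → subst (λ z → P (f z) (f (L ∸ suc j))) (sym (L∸j≡1+L∸[1+j] j<L))
       (sym-P (steps (L ∸ suc j) (ℕP.∸-monoʳ-< {L} {suc j} {0} (ℕ.s≤s ℕ.z≤n) j<L))))
    where
    L∸j≡1+L∸[1+j] : ∀ {L j} → j ℕ.< L → L ∸ j ≡ suc (L ∸ suc j)
    L∸j≡1+L∸[1+j] {suc L} {zero} _ = refl
    L∸j≡1+L∸[1+j] {suc L} {suc j} (ℕ.s≤s j<L) = L∸j≡1+L∸[1+j] j<L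

  module CutOut {u v L} (w : FunWalk P u v L) {a b} (a<b : a ℕ.< b) (b≤L : b ℕ.≤ L)
                (fa≡fb : FunWalk.at w a ≡ FunWalk.at w b) where

    open FunWalk w renaming (at to f; at-0 to f0; at-L to fL)

    d : ℕ
    d = b ∸ a

    L′ : ℕ
    L′ = L ∸ d

    L′+d≡L : L′ ℕ.+ d ≡ L
    L′+d≡L = ℕP.m∸n+n≡m (ℕP.≤-trans (ℕP.m∸n≤m b a) b≤L)

    a≤L′ : a ℕ.≤ L′
    a≤L′ = subst (ℕ._≤ L′) (ℕP.m∸[m∸n]≡n (ℕP.<⇒≤ a<b)) (ℕP.∸-monoˡ-≤ d b≤L)

    a+d≡b : a ℕ.+ d ≡ b
    a+d≡b = ℕP.m+[n∸m]≡n (ℕP.<⇒≤ a<b)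

    g : ℕ → Fin n
    g j with j ℕ.≤? a
    ... | yes _ = f j
    ... | no _ = f (j ℕ.+ d)

    g-low : ∀ j → j ℕ.≤ a → g j ≡ f j
    g-low j j≤a with j ℕ.≤? a
    ... | yes _ = refl
    ... | no j≰a = ⊥-elim (j≰a j≤a)

    g-high : ∀ j → ¬ (j ℕ.≤ a) → g j ≡ f (j ℕ.+ d)
    g-high j j≰a with j ℕ.≤? a
    ... | yes j≤a = ⊥-elim (j≰a j≤a)
    ... | no _ = refl

    g0 : g 0 ≡ u
    g0 = trans (g-low 0 ℕ.z≤n) f0

    reaches-v : Dec (L′ ℕ.≤ a) → g L′ ≡ v
    reaches-v (yes L′≤a) = trans (g-low L′ L′≤a) (trans (cong f L′≡a) (trans fa≡fb (trans (cong f b≡L) fL)))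
      where
      L′≡a : L′ ≡ a
      L′≡a = ℕP.≤-antisym L′≤a a≤L′
      b≡L : b ≡ L
      b≡L = trans (sym a+d≡b) (trans (cong (ℕ._+ d) (sym L′≡a)) L′+d≡L)
    reaches-v (no L′≰a) = trans (g-high L′ L′≰a) (trans (cong f L′+d≡L) fL)

    gL′ : g L′ ≡ v
    gL′ = reaches-v (L′ ℕ.≤? a)

    <L : ∀ {j} → j ℕ.< L′ → j ℕ.+ d ℕ.< L
    <L j<L′ = ℕP.<-≤-trans (ℕP.+-monoˡ-< d j<L′) (ℕP.≤-reflexive L′+d≡L)

    g-steps′ : ∀ j → j ℕ.< L′ → Dec (suc j ℕ.≤ a) → Dec (j ℕ.≤ a) → P (g j) (g (suc j))
    g-steps′ j j<L′ (yes j<a) _ = subst₂ P (sym (g-low j (ℕP.<⇒≤ j<a))) (sym (g-low (suc j) j<a))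
                          (steps j (ℕP.<-≤-trans j<L′ (ℕP.m∸n≤m L d)))
    g-steps′ j j<L′ (no _) (no j≰a) = subst₂ P (sym (g-high j j≰a)) (sym (g-high (suc j) (λ j<a → j≰a (ℕP.<⇒≤ j<a))))
                          (steps (j ℕ.+ d) (<L j<L′))
    g-steps′ j j<L′ (no j≮a) (yes j≤a) = subst₂ P (sym (trans (g-low j j≤a) (trans (cong f j≡a) fa≡fb)))
                               (sym (trans (g-high (suc j) j≮a) (cong (λ z → f (suc z)) j+d≡b)))
                               (steps b (subst (ℕ._< L) j+d≡b (<L j<L′)))
      where
      j≡a : j ≡ a
      j≡a = ℕP.≤-antisym j≤a (ℕP.≤-pred (ℕP.≰⇒> j≮a))
      j+d≡b : j ℕ.+ d ≡ b
      j+d≡b = trans (cong (ℕ._+ d) j≡a) a+d≡b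

    g-steps : ∀ j → j ℕ.< L′ → P (g j) (g (suc j))
    g-steps j j<L′ = g-steps′ j j<L′ (suc j ℕ.≤? a) (j ℕ.≤? a)

    walk : FunWalk P u v (L ∸ (b ∸ a))
    walk = funWalk g g0 gL′ g-steps

module Ears {n} (G : Graph n) (C : Cycle G) (uni : UnicyclicWith G C) where

  open CycleIndexing G C
  open A using (_≋_; mk≋; ≋-sym; ≋-trans; ≋-resp; residue; residue<M; ≋⇒≡-below)

  record Ear (t t' : Fin m) (L : ℕ) : Set where
    field
      walk     : FunWalk (AdjOff C) (cv t) (cv t') L
      nonempty : 1 ℕ.≤ L
      simple   : ∀ i j → i ℕ.≤ L → j ℕ.≤ L → FunWalk.at walk i ≡ FunWalk.at walk j → i ≡ j
      interior : ∀ k → 0 ℕ.< k → k ℕ.< L → ¬ OnCycle (FunWalk.at walk k)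

  -- The ear from cv t to cv t' followed by the arc of C from cv t' to cv t' + Ar = cv t is a
  -- cycle of length L + Ar ≥ 3; its first edge lies off C, contradicting unicyclicity.
  module EarPlusArc {t t' L} (ear : Ear t t' L) (Ar : ℕ) (2≤Ar : 2 ℕ.≤ Ar) (Ar<m : Ar ℕ.< m)
                    (t≋t'+Ar : position t ≋ position t' ℤ.+ + Ar) where

    open Ear ear
    open FunWalk walk renaming (at to f; at-0 to f0; at-L to fL)

    a : ℕ
    a = toℕ t'

    h′ : ∀ k → Dec (k ℕ.< L) → Fin n
    h′ k (yes _) = f k
    h′ k (no _) = cycVertex (a ℕ.+ (k ∸ L))

    h : ℕ → Fin n
    h k = h′ k (k ℕ.<? L)

    h-ear : ∀ k → k ℕ.< L → h k ≡ f k
    h-ear k k<L with k ℕ.<? L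
    ... | yes _ = refl
    ... | no k≮L = ⊥-elim (k≮L k<L)

    h-arc : ∀ k → L ℕ.≤ k → h k ≡ cycVertex (a ℕ.+ (k ∸ L))
    h-arc k L≤k with k ℕ.<? L
    ... | yes k<L = ⊥-elim (ℕP.<⇒≱ k<L L≤k)
    ... | no _ = refl

    fL≡cycVertex-a : f L ≡ cycVertex a
    fL≡cycVertex-a = trans fL (sym (cycVertex-toℕ t'))

    h-ear≤ : ∀ k → k ℕ.≤ L → h k ≡ f k
    h-ear≤ k k≤L with k ℕ.<? L
    ... | yes _ = refl
    ... | no k≮L rewrite ℕP.≤-antisym k≤L (ℕP.≮⇒≥ k≮L) | ℕP.n∸n≡0 L | ℕP.+-identityʳ a = sym fL≡cycVertex-a

    cv-t≡ : cv t ≡ cycVertex (a ℕ.+ Ar)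
    cv-t≡ = trans (sym (cycVertex-toℕ t)) (cycVertex-cong (≋-resp refl (sym (ℤP.pos-+ a Ar)) t≋t'+Ar))

    arc-injective : ∀ j₁ j₂ → j₁ ℕ.< m → j₂ ℕ.< m → cycVertex (a ℕ.+ j₁) ≡ cycVertex (a ℕ.+ j₂) → j₁ ≡ j₂
    arc-injective j₁ j₂ j₁<m j₂<m e = ≋⇒≡-below j₁<m j₂<m
      (A.≋-cancelˡ {+ a} (≋-resp (ℤP.pos-+ a j₁) (ℤP.pos-+ a j₂) (cycVertex-injective e)))

    ∸L<Ar : ∀ {y} → L ℕ.≤ y → y ℕ.< L ℕ.+ Ar → y ∸ L ℕ.< Ar
    ∸L<Ar {y} L≤y y< = ℕP.+-cancelˡ-< L (y ∸ L) Ar (subst (ℕ._< L ℕ.+ Ar) (sym (ℕP.m+[n∸m]≡n L≤y)) y<)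

    ear≢arc : ∀ x y → x ℕ.< L → L ℕ.≤ y → y ℕ.< L ℕ.+ Ar → h x ≢ h y
    ear≢arc zero y 0<L L≤y y< e = ℕP.<-irrefl (sym Ar≡) (∸L<Ar L≤y y<)
      where
      Ar≡ : Ar ≡ y ∸ L
      Ar≡ = arc-injective Ar (y ∸ L) Ar<m (ℕP.<-trans (∸L<Ar L≤y y<) Ar<m)
              (trans (sym cv-t≡) (trans (sym f0) (trans (sym (h-ear 0 0<L)) (trans e (h-arc y L≤y)))))
    ear≢arc (suc x) y x<L L≤y _ e =
      interior (suc x) (ℕ.s≤s ℕ.z≤n) x<L (index (a ℕ.+ (y ∸ L)) , trans (sym (h-arc y L≤y)) (trans (sym e) (h-ear (suc x) x<L)))

    h-injective : ∀ x y → x ℕ.< L ℕ.+ Ar → y ℕ.< L ℕ.+ Ar → h x ≡ h y → x ≡ y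
    h-injective x y x< y< e = by-cases (x ℕ.<? L) (y ℕ.<? L)
      where
      by-cases : Dec (x ℕ.< L) → Dec (y ℕ.< L) → x ≡ y
      by-cases (yes x<L) (yes y<L) = simple x y (ℕP.<⇒≤ x<L) (ℕP.<⇒≤ y<L) (trans (sym (h-ear x x<L)) (trans e (h-ear y y<L)))
      by-cases (yes x<L) (no y≮L) = ⊥-elim (ear≢arc x y x<L (ℕP.≮⇒≥ y≮L) y< e)
      by-cases (no x≮L) (yes y<L) = ⊥-elim (ear≢arc y x y<L (ℕP.≮⇒≥ x≮L) x< (sym e))
      by-cases (no x≮L) (no y≮L) = trans (sym (ℕP.m∸n+n≡m L≤x)) (trans (cong (ℕ._+ L) x∸L≡y∸L) (ℕP.m∸n+n≡m L≤y))
        where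
        L≤x : L ℕ.≤ x
        L≤x = ℕP.≮⇒≥ x≮L
        L≤y : L ℕ.≤ y
        L≤y = ℕP.≮⇒≥ y≮L
        x∸L≡y∸L : x ∸ L ≡ y ∸ L
        x∸L≡y∸L = arc-injective _ _ (ℕP.<-trans (∸L<Ar L≤x x<) Ar<m) (ℕP.<-trans (∸L<Ar L≤y y<) Ar<m)
                    (trans (sym (h-arc x L≤x)) (trans e (h-arc y L≤y)))

    h-adj : ∀ k → Adj G (h k) (h (suc k))
    h-adj k with k ℕ.<? L
    ... | yes k<L = subst (Adj G (f k)) (sym (h-ear≤ (suc k) k<L)) (proj₁ (steps k k<L))
    ... | no k≮L = subst (Adj G (cycVertex (a ℕ.+ (k ∸ L)))) (sym (trans (h-arc (suc k) (ℕP.m≤n⇒m≤1+n L≤k)) next))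
                     (cycVertex-adj (a ℕ.+ (k ∸ L)))
      where
      L≤k = ℕP.≮⇒≥ k≮L
      next : cycVertex (a ℕ.+ (suc k ∸ L)) ≡ cycVertex (suc (a ℕ.+ (k ∸ L)))
      next = cong cycVertex (trans (cong (a ℕ.+_) (ℕP.+-∸-assoc 1 L≤k)) (ℕP.+-suc a (k ∸ L)))

    closing-adj : ∀ k → suc k ≡ L ℕ.+ Ar → Adj G (h k) (h 0)
    closing-adj k 1+k≡ = subst₂ (Adj G) (sym (h-arc k L≤k)) (sym h0≡) (cycVertex-adj (a ℕ.+ (k ∸ L)))
      where
      L≤k : L ℕ.≤ k
      L≤k = ℕP.≤-pred (subst (suc L ℕ.≤_) (sym 1+k≡)
              (subst (ℕ._≤ L ℕ.+ Ar) (ℕP.+-comm L 1) (ℕP.+-monoʳ-≤ L (ℕP.≤-trans (ℕP.n≤1+n 1) 2≤Ar))))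
      1+[k∸L]≡Ar : suc (k ∸ L) ≡ Ar
      1+[k∸L]≡Ar = trans (sym (ℕP.+-∸-assoc 1 L≤k)) (trans (cong (_∸ L) 1+k≡) (ℕP.m+n∸m≡n L Ar))
      h0≡ : h 0 ≡ cycVertex (suc (a ℕ.+ (k ∸ L)))
      h0≡ = trans (h-ear 0 nonempty) (trans f0 (trans cv-t≡
              (cong cycVertex (trans (cong (a ℕ.+_) (sym 1+[k∸L]≡Ar)) (ℕP.+-suc a (k ∸ L))))))

    second : Cycle G
    second = record
      { len = L ℕ.+ Ar
      ; len≥3 = ℕP.+-mono-≤ nonempty 2≤Ar
      ; vert = λ k → h (toℕ k)
      ; distinct = λ i j e → FinP.toℕ-injective (h-injective (toℕ i) (toℕ j) (FinP.toℕ<n i) (FinP.toℕ<n j) e)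
      ; closed = closed′
      }
      where
      closed′ : ∀ i j → CycSucc (L ℕ.+ Ar) i j → Adj G (h (toℕ i)) (h (toℕ j))
      closed′ i j (inj₁ e) = subst (λ z → Adj G (h (toℕ i)) (h z)) (sym e) (h-adj (toℕ i))
      closed′ i j (inj₂ (e₁ , e₂)) = subst (λ z → Adj G (h (toℕ i)) (h z)) (sym e₂) (closing-adj (toℕ i) e₁)

    first-edge-on-second : CycEdge second (f 0) (f 1)
    first-edge-on-second = i₀ , i₁ , inj₁ (trans (FinP.toℕ-fromℕ< 1<) (cong suc (sym (FinP.toℕ-fromℕ< 0<)))) ,
      inj₁ (trans (cong h (FinP.toℕ-fromℕ< 0<)) (h-ear 0 nonempty) , trans (cong h (FinP.toℕ-fromℕ< 1<)) (h-ear≤ 1 nonempty))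
      where
      0< : 0 ℕ.< L ℕ.+ Ar
      0< = ℕP.<-≤-trans nonempty (ℕP.m≤m+n L Ar)
      1< : 1 ℕ.< L ℕ.+ Ar
      1< = ℕP.≤-trans (ℕP.n≤1+n 2) (ℕP.+-mono-≤ nonempty 2≤Ar)
      i₀ : Fin (L ℕ.+ Ar)
      i₀ = fromℕ< 0<
      i₁ : Fin (L ℕ.+ Ar)
      i₁ = fromℕ< 1<

    impossible : ⊥
    impossible = proj₂ (steps 0 nonempty) (proj₁ (proj₂ uni second (f 0) (f 1)) first-edge-on-second)

  reverse-ear : ∀ {t t' L} → Ear t t' L → Ear t' t L
  reverse-ear {L = L} ear = record
    { walk = reverse adjOff-sym walk
    ; nonempty = nonempty
    ; simple = λ i j i≤L j≤L e → ℕP.∸-cancelˡ-≡ i≤L j≤L (simple (L ∸ i) (L ∸ j) (ℕP.m∸n≤m L i) (ℕP.m∸n≤m L j) e)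
    ; interior = λ k 0<k k<L → interior (L ∸ k) (ℕP.m<n⇒0<n∸m k<L) (ℕP.∸-monoʳ-< {L} {k} {0} 0<k (ℕP.<⇒≤ k<L))
    }
    where open Ear ear

  -- Going around C from the far end of the ear, the arc back to its start has length at least 2
  -- in one of the two directions, because m ≥ 3.
  no-ear : ∀ {t t' L} → t ≢ t' → ¬ Ear t t' L
  no-ear {t} {t'} t≢t' ear = by-length (2 ℕ.≤? Ar₀)
    where
    Ar₀ : ℕ
    Ar₀ = residue (position t ℤ.- position t')
    t≋t'+Ar₀ : position t ≋ position t' ℤ.+ + Ar₀
    t≋t'+Ar₀ = A.≋-+residue (position t') (position t)
    1≤m : 1 ℕ.≤ m
    1≤m = ℕ.>-nonZero⁻¹ m
    m∸1<m : m ∸ 1 ℕ.< m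
    m∸1<m = ℕP.∸-monoʳ-< {m} {1} {0} (ℕ.s≤s ℕ.z≤n) 1≤m
    wrap : ∀ x m → x ℤ.+ (m ℤ.- + 1) ≡ (x ℤ.+ (- + 1)) ℤ.+ + 1 ℤ.* m
    wrap = solve-∀
    t'≋t+[m∸1] : Ar₀ ≡ 1 → position t' ≋ position t ℤ.+ + (m ∸ 1)
    t'≋t+[m∸1] Ar₀≡1 =
      ≋-trans (A.≋-flip {position t'} {position t} {+ 1} (subst (λ z → position t ≋ position t' ℤ.+ + z) Ar₀≡1 t≋t'+Ar₀))
        (≋-sym (mk≋ (+ 1) (trans (cong (λ z → position t ℤ.+ z) (A.+[M∸r]≡M-r 1≤m)) (wrap (position t) (+ m)))))
    Ar₀≢0 : Ar₀ ≢ 0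
    Ar₀≢0 Ar₀≡0 = t≢t' (position-injective (≋-trans t≋t'+Ar₀
                    (A.≋-reflexive (trans (cong (λ z → position t' ℤ.+ + z) Ar₀≡0) (ℤP.+-identityʳ _)))))
    by-length : Dec (2 ℕ.≤ Ar₀) → ⊥
    by-length (yes 2≤Ar₀) = EarPlusArc.impossible ear Ar₀ 2≤Ar₀ (residue<M _) t≋t'+Ar₀
    by-length (no 2≰Ar₀) = EarPlusArc.impossible (reverse-ear ear) (m ∸ 1) (ℕP.∸-monoˡ-≤ 1 (len≥3 C)) m∸1<m
                             (t'≋t+[m∸1] (ℕP.≤-antisym (ℕP.≤-pred (ℕP.≰⇒> 2≰Ar₀)) (ℕP.n≢0⇒n>0 Ar₀≢0)))

  funWalk⇒ear : ∀ {t t' L} → t ≢ t' → (w : FunWalk (AdjOff C) (cv t) (cv t') L) →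
                (∀ i j → i ℕ.< j → j ℕ.≤ L → FunWalk.at w i ≢ FunWalk.at w j) →
                (∀ k → 0 ℕ.< k → k ℕ.< L → ¬ OnCycle (FunWalk.at w k)) → Ear t t' L
  funWalk⇒ear {t} {t'} {L} t≢t' w no-repeat interior = record
    { walk = w
    ; nonempty = nonempty L fL
    ; simple = simple
    ; interior = interior
    }
    where
    open FunWalk w renaming (at to f; at-0 to f0; at-L to fL)
    nonempty : ∀ x → f x ≡ cv t' → 1 ℕ.≤ x
    nonempty zero e = ⊥-elim (t≢t' (distinct C t t' (trans (sym f0) e)))
    nonempty (suc _) _ = ℕ.s≤s ℕ.z≤n
    simple : ∀ i j → i ℕ.≤ L → j ℕ.≤ L → f i ≡ f j → i ≡ j
    simple i j i≤L j≤L e with ℕP.<-cmp i j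
    ... | tri< i<j _ _ = ⊥-elim (no-repeat i j i<j j≤L e)
    ... | tri≈ _ i≡j _ = i≡j
    ... | tri> _ _ j<i = ⊥-elim (no-repeat j i j<i i≤L (sym e))

  -- Induction on the length: an interior cycle vertex or a repeated vertex yields a shorter such
  -- walk; otherwise the walk is an ear.
  no-off-cycle-funWalk : ∀ N {L t t'} → L ℕ.< N → t ≢ t' → ¬ FunWalk (AdjOff C) (cv t) (cv t') L
  no-off-cycle-funWalk (suc N) {L} {t} {t'} L<1+N t≢t' w = by-interior (bounded-search Interior interior? L)
    where
    open FunWalk w renaming (at to f; at-0 to f0; at-L to fL)
    shorter : ∀ {x} → x ℕ.< L → x ℕ.< N
    shorter x<L = ℕP.<-≤-trans x<L (ℕP.≤-pred L<1+N)
    Interior : ℕ → Set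
    Interior k = (0 ℕ.< k) × OnCycle (f k)
    interior? : ∀ k → Dec (Interior k)
    interior? k = (0 ℕ.<? k) ×-dec onCycle? (f k)
    Repeat : ℕ → Set
    Repeat b = Σ ℕ λ a → a ℕ.< b × f a ≡ f b
    repeat? : ∀ b → Dec (Repeat b)
    repeat? b with bounded-search (λ a → f a ≡ f b) (λ a → f a Fin.≟ f b) b
    ... | inj₁ r = yes r
    ... | inj₂ none = no λ (a , a<b , e) → none a a<b e
    through : ∀ k r → 0 ℕ.< k → k ℕ.< L → cv r ≡ f k → Dec (r ≡ t) → ⊥
    through k r 0<k k<L cv-r≡ (yes refl) = no-off-cycle-funWalk N (shorter (ℕP.∸-monoʳ-< {L} {k} {0} 0<k (ℕP.<⇒≤ k<L))) t≢t'
      (subst (λ z → FunWalk (AdjOff C) z (cv t') (L ∸ k)) (sym cv-r≡) (suffix w k (ℕP.<⇒≤ k<L)))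
    through k r 0<k k<L cv-r≡ (no r≢t) = no-off-cycle-funWalk N (shorter k<L) (λ t≡r → r≢t (sym t≡r))
      (subst (λ z → FunWalk (AdjOff C) (cv t) z k) (sym cv-r≡) (prefix w k (ℕP.<⇒≤ k<L)))
    by-repeat : (Σ ℕ λ k → k ℕ.< suc L × Repeat k) ⊎ (∀ k → k ℕ.< suc L → ¬ Repeat k) →
                (∀ k → k ℕ.< L → ¬ Interior k) → ⊥
    by-repeat (inj₁ (b , b<1+L , (a , a<b , e))) _ = no-off-cycle-funWalk N
      (shorter (ℕP.∸-monoʳ-< {L} {b ∸ a} {0} (ℕP.m<n⇒0<n∸m a<b) (ℕP.≤-trans (ℕP.m∸n≤m b a) (ℕP.≤-pred b<1+L)))) t≢t'
      (CutOut.walk w a<b (ℕP.≤-pred b<1+L) e)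
    by-repeat (inj₂ no-repeat) no-interior = no-ear t≢t' (funWalk⇒ear t≢t' w
      (λ i j i<j j≤L e → no-repeat j (ℕ.s≤s j≤L) (i , i<j , e)) (λ k 0<k k<L on → no-interior k k<L (0<k , on)))
    by-interior : (Σ ℕ λ k → k ℕ.< L × Interior k) ⊎ (∀ k → k ℕ.< L → ¬ Interior k) → ⊥
    by-interior (inj₁ (k , k<L , (0<k , (r , cv-r≡)))) = through k r 0<k k<L cv-r≡ (r Fin.≟ t)
    by-interior (inj₂ no-interior) = by-repeat (bounded-search Repeat repeat? (suc L)) no-interior

  off-cycle-walk⇒≡ : ∀ {L} t t' → WalkIn (AdjOff C) (cv t) (cv t') L → t ≡ t'
  off-cycle-walk⇒≡ {L} t t' w with t Fin.≟ t'
  ... | yes t≡t' = t≡t'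
  ... | no t≢t' = ⊥-elim (no-off-cycle-funWalk (suc L) (ℕP.n<1+n L) t≢t' (toFunWalk w))

SameEdge-trans : ∀ {n} {a b u v x y : Fin n} → SameEdge a b u v → SameEdge a b x y → SameEdge u v x y
SameEdge-trans (inj₁ (refl , refl)) (inj₁ (refl , refl)) = inj₁ (refl , refl)
SameEdge-trans (inj₁ (refl , refl)) (inj₂ (refl , refl)) = inj₂ (refl , refl)
SameEdge-trans (inj₂ (refl , refl)) (inj₁ (refl , refl)) = inj₂ (refl , refl)
SameEdge-trans (inj₂ (refl , refl)) (inj₂ (refl , refl)) = inj₁ (refl , refl)

-- The root of w ends a shortest walk in G − E(C) from w to C; it is unique because distinct
-- vertices of C are not joined in G − E(C).
module Roots {n} (G : Graph n) (C : Cycle G) (uni : UnicyclicWith G C) where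

  open CycleIndexing G C
  open Ears G C uni using (off-cycle-walk⇒≡)

  adjOff? : ∀ u v → Dec (AdjOff C u v)
  adjOff? u v = (adj G u v BoolP.≟ true) ×-dec ¬? (cycEdge? u v)

  offWalk? : ∀ k u v → Dec (WalkIn (AdjOff C) u v k)
  offWalk? zero u v with u Fin.≟ v
  ... | yes refl = yes here
  ... | no u≢v = no λ { here → u≢v refl }
  offWalk? (suc k) u v with FinP.any? (λ w → adjOff? u w ×-dec offWalk? k w v)
  ... | yes (w , p , q) = yes (step p q)
  ... | no none = no λ { (step {w = w} p q) → none (w , p , q) }

  ReachesCycle : Fin n → ℕ → Set
  ReachesCycle w k = Σ (Fin m) λ t → WalkIn (AdjOff C) w (cv t) k

  reachesCycle? : ∀ w k → Dec (ReachesCycle w k)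
  reachesCycle? w k = FinP.any? λ t → offWalk? k w (cv t)

  -- Cut a walk in G at its first vertex on C: every earlier edge has an endpoint off C.
  walk⇒reachesCycle : ∀ {w v k} → Walk G w v k → OnCycle v → Σ ℕ (ReachesCycle w)
  walk⇒reachesCycle {w} here (t , cv-t≡w) = 0 , t , subst (λ z → WalkIn (AdjOff C) z (cv t) 0) cv-t≡w here
  walk⇒reachesCycle {w} (step p rest) on-v with onCycle? w
  ... | yes (t , cv-t≡w) = 0 , t , subst (λ z → WalkIn (AdjOff C) z (cv t) 0) cv-t≡w here
  ... | no w-off with walk⇒reachesCycle rest on-v
  ... | k , t , q = suc k , t , step (p , λ e → w-off (cycEdge⇒onCycle e)) q

  private
    shortest : ∀ w → Σ ℕ λ k → ReachesCycle w k × (∀ j → j ℕ.< k → ¬ ReachesCycle w j)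
    shortest w = minimal-witness (ReachesCycle w) (reachesCycle? w) _ (proj₂ reach)
      where
      c₀ : Fin m
      c₀ = fromℕ< (ℕ.>-nonZero⁻¹ m)
      reach : Σ ℕ (ReachesCycle w)
      reach = walk⇒reachesCycle (proj₂ (proj₁ uni w (cv c₀))) (c₀ , refl)

  height : Fin n → ℕ
  height w = proj₁ (shortest w)

  root : Fin n → Fin m
  root w = proj₁ (proj₁ (proj₂ (shortest w)))

  height-walk : ∀ w → WalkIn (AdjOff C) w (cv (root w)) (height w)
  height-walk w = proj₂ (proj₁ (proj₂ (shortest w)))

  height-minimal : ∀ w t j → WalkIn (AdjOff C) w (cv t) j → height w ℕ.≤ j
  height-minimal w t j q with height w ℕ.≤? j
  ... | yes h≤j = h≤j
  ... | no h≰j = ⊥-elim (proj₂ (proj₂ (shortest w)) j (ℕP.≰⇒> h≰j) (t , q))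

  root-unique : ∀ w t j → WalkIn (AdjOff C) w (cv t) j → root w ≡ t
  root-unique w t j q = off-cycle-walk⇒≡ (root w) t (reverseʷ adjOff-sym (height-walk w) ++ʷ q)

  height-cv : ∀ t → height (cv t) ≡ 0
  height-cv t = ℕP.n≤0⇒n≡0 (height-minimal (cv t) t 0 here)

  root-cv : ∀ t → root (cv t) ≡ t
  root-cv t = root-unique (cv t) t 0 here

  height-adjOff : ∀ {w w'} → AdjOff C w w' → height w ℕ.≤ suc (height w')
  height-adjOff {w} {w'} p = height-minimal w (root w') (suc (height w')) (step p (height-walk w'))

  root-adjOff : ∀ {w w'} → AdjOff C w w' → root w ≡ root w'
  root-adjOff {w} {w'} p = root-unique w (root w') (suc (height w')) (step p (height-walk w'))

module DistanceFormula {n} (G : Graph n) (C : Cycle G) (uni : UnicyclicWith G C) where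

  open CycleIndexing G C
  open Roots G C uni

  cycDist : Fin m → Fin m → ℕ
  cycDist t s = A.dist (position t) (position s)

  viaRoot : Fin m → Fin n → ℕ
  viaRoot s w = height w ℕ.+ cycDist (root w) s

  viaRoot-cv : ∀ s t → viaRoot s (cv t) ≡ cycDist t s
  viaRoot-cv s t = trans (cong (ℕ._+ cycDist (root (cv t)) s) (height-cv t)) (cong (λ z → cycDist z s) (root-cv t))

  cycDist-CycSucc : ∀ {i j} s → CycSucc m i j → cycDist i s ℕ.≤ suc (cycDist j s) × cycDist j s ℕ.≤ suc (cycDist i s)
  cycDist-CycSucc {i} {j} s ij =
    ℕP.≤-trans (A.dist-triangle (position i) (position j) (position s)) (ℕP.+-monoˡ-≤ (cycDist j s) dij≤1) ,
    ℕP.≤-trans (A.dist-triangle (position j) (position i) (position s)) (ℕP.+-monoˡ-≤ (cycDist i s) dji≤1)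
    where
    dij≤1 : cycDist i j ℕ.≤ 1
    dij≤1 = A.dist-minimal (position i) (position j) (+ 1) (CycSucc⇒≋suc ij)
    dji≤1 : cycDist j i ℕ.≤ 1
    dji≤1 = A.dist-minimal (position j) (position i) (- + 1) (A.≋-flip {position i} {position j} {+ 1} (CycSucc⇒≋suc ij))

  viaRoot-adj : ∀ s {w w'} → Adj G w w' → viaRoot s w ℕ.≤ suc (viaRoot s w')
  viaRoot-adj s {w} {w'} a with cycEdge? w w'
  ... | yes (i , j , ij , inj₁ (refl , refl)) =
    subst₂ (λ x y → x ℕ.≤ suc y) (sym (viaRoot-cv s i)) (sym (viaRoot-cv s j)) (proj₁ (cycDist-CycSucc s ij))
  ... | yes (i , j , ij , inj₂ (refl , refl)) =
    subst₂ (λ x y → x ℕ.≤ suc y) (sym (viaRoot-cv s j)) (sym (viaRoot-cv s i)) (proj₂ (cycDist-CycSucc s ij))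
  ... | no off = subst (λ z → height w ℕ.+ cycDist z s ℕ.≤ suc (viaRoot s w')) (sym (root-adjOff (a , off)))
                   (ℕP.+-monoˡ-≤ (cycDist (root w') s) (height-adjOff (a , off)))

  viaRoot≤length : ∀ s {w k} → Walk G w (cv s) k → viaRoot s w ℕ.≤ k
  viaRoot≤length s here = ℕP.≤-reflexive (trans (viaRoot-cv s s) (A.dist-self (position s)))
  viaRoot≤length s (step a rest) = ℕP.≤-trans (viaRoot-adj s a) (ℕ.s≤s (viaRoot≤length s rest))

  walk-along-cycle : ∀ t s e → position s A.≋ position t ℤ.+ e → Walk G (cv t) (cv s) ∣ e ∣
  walk-along-cycle t s (+ k) p =
    subst₂ (λ x y → Walk G x y k) (cycVertex-toℕ t)
      (trans (cycVertex-cong (A.≋-resp (ℤP.pos-+ (toℕ t) k) refl (A.≋-sym p))) (cycVertex-toℕ s))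
      (arc-walk (toℕ t) k)
  walk-along-cycle t s -[1+ k ] p =
    reverseʷ (λ {a} {b} → Graph.sym G a b)
      (subst₂ (λ x y → Walk G x y (suc k)) (cycVertex-toℕ s)
        (trans (cycVertex-cong (A.≋-resp (ℤP.pos-+ (toℕ s) (suc k)) refl
                 (A.≋-sym (A.≋-flip {position t} {position s} { -[1+ k ]} p)))) (cycVertex-toℕ t))
        (arc-walk (toℕ s) (suc k)))

  cycDist-walk : ∀ t s → Walk G (cv t) (cv s) (cycDist t s)
  cycDist-walk t s with A.dist-realised (position t) (position s)
  ... | e , p , ∣e∣≡ = subst (Walk G (cv t) (cv s)) ∣e∣≡ (walk-along-cycle t s e p)

  viaRoot-walk : ∀ s w → Walk G w (cv s) (viaRoot s w)
  viaRoot-walk s w = mapʷ proj₁ (height-walk w) ++ʷ cycDist-walk (root w) s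

  Dist⇒≡viaRoot : ∀ s w k → Dist G w (cv s) k → k ≡ viaRoot s w
  Dist⇒≡viaRoot s w k (walk , shortest) = ℕP.≤-antisym (shortest _ (viaRoot-walk s w)) (viaRoot≤length s walk)

  EdgeDist⇒≡viaRoot : ∀ s u v a → EdgeDist G u v (cv s) a → a ≡ viaRoot s u ⊓ viaRoot s v
  EdgeDist⇒≡viaRoot s u v a (a₁ , b₁ , d₁ , d₂ , a≡) =
    trans a≡ (cong₂ _⊓_ (Dist⇒≡viaRoot s u a₁ d₁) (Dist⇒≡viaRoot s v b₁ d₂))

module EdgeCoordinates {n} (G : Graph n) (C : Cycle G) (uni : UnicyclicWith G C) where

  open CycleIndexing G C
  open Roots G C uni
  open DistanceFormula G C uni
  module D = Doubling m
  module B = D.B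

  double : Fin m → ℤ
  double t = position t ℤ.+ position t

  edgeDist : Fin m → Fin n → Fin n → ℕ
  edgeDist s a b = viaRoot s a ⊓ viaRoot s b

  data EdgeKind (a b : Fin n) : Set where
    on-cycle  : ∀ i j → CycSucc m i j → SameEdge (cv i) (cv j) a b → EdgeKind a b
    off-cycle : AdjOff C a b → EdgeKind a b

  edgeKind : ∀ {a b} → Adj G a b → EdgeKind a b
  edgeKind {a} {b} ab with cycEdge? a b
  ... | yes (i , j , ij , same) = on-cycle i j ij same
  ... | no off = off-cycle (ab , off)

  point : ∀ {a b} → EdgeKind a b → ℤ
  point (on-cycle i _ _ _) = double i ℤ.+ + 1
  point {a} (off-cycle _) = double (root a)

  raise : ∀ {a b} → EdgeKind a b → ℕ
  raise (on-cycle _ _ _ _) = 0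
  raise {a} {b} (off-cycle _) = (height a ⊓ height b) ℕ.+ (height a ⊓ height b)

  oddness : ∀ {a b} → EdgeKind a b → ℕ
  oddness (on-cycle _ _ _ _) = 1
  oddness (off-cycle _) = 0

  edgeDist-doubled : ∀ {a b} (κ : EdgeKind a b) s →
                     edgeDist s a b ℕ.+ edgeDist s a b ℕ.+ oddness κ ≡ raise κ ℕ.+ B.dist (point κ) (double s)
  edgeDist-doubled (on-cycle i j ij same) s = trans (cong (λ z → z ℕ.+ z ℕ.+ 1) (edgeDist≡ same)) midpoint
    where
    edgeDist≡ : ∀ {a b} → SameEdge (cv i) (cv j) a b → edgeDist s a b ≡ cycDist i s ⊓ cycDist j s
    edgeDist≡ (inj₁ (refl , refl)) = cong₂ _⊓_ (viaRoot-cv s i) (viaRoot-cv s j)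
    edgeDist≡ (inj₂ (refl , refl)) = trans (cong₂ _⊓_ (viaRoot-cv s j) (viaRoot-cv s i)) (ℕP.⊓-comm (cycDist j s) (cycDist i s))
    midpoint : (cycDist i s ⊓ cycDist j s) ℕ.+ (cycDist i s ⊓ cycDist j s) ℕ.+ 1 ≡ B.dist (double i ℤ.+ + 1) (double s)
    midpoint = trans (ℕP.+-comm _ 1) (sym (D.dist-midpoint (position i) (position j) (position s) (CycSucc⇒≋suc ij)))
  edgeDist-doubled {a} {b} (off-cycle ab) s = begin
    edgeDist s a b ℕ.+ edgeDist s a b ℕ.+ 0  ≡⟨ cong (λ z → z ℕ.+ z ℕ.+ 0) edgeDist≡ ⟩
    (H ℕ.+ d) ℕ.+ (H ℕ.+ d) ℕ.+ 0            ≡⟨ regroup H d ⟩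
    (H ℕ.+ H) ℕ.+ (d ℕ.+ d)                  ≡⟨ cong (H ℕ.+ H ℕ.+_) (D.dist-double (position (root a)) (position s)) ⟨
    (H ℕ.+ H) ℕ.+ B.dist (double (root a)) (double s) ∎
    where
    open ≡-Reasoning
    H : ℕ
    H = height a ⊓ height b
    d : ℕ
    d = cycDist (root a) s
    edgeDist≡ : edgeDist s a b ≡ H ℕ.+ d
    edgeDist≡ = trans (cong (λ z → viaRoot s a ⊓ (height b ℕ.+ cycDist z s)) (sym (root-adjOff ab)))
                  (sym (ℕP.+-distribʳ-⊓ d (height a) (height b)))
    regroup : ∀ H d → (H ℕ.+ d) ℕ.+ (H ℕ.+ d) ℕ.+ 0 ≡ (H ℕ.+ H) ℕ.+ (d ℕ.+ d)
    regroup = ℕSolver.solve-∀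

  point-≋⇒same : ∀ {u v x y} (κ₁ : EdgeKind u v) (κ₂ : EdgeKind x y) → point κ₁ B.≋ point κ₂ →
                 SameEdge u v x y ⊎ SameComp C u v x y
  point-≋⇒same (on-cycle i₁ j₁ ij₁ same₁) (on-cycle i₂ j₂ ij₂ same₂) p =
    inj₁ (SameEdge-trans (subst₂ (λ a b → SameEdge a b _ _) (cong cv i₁≡i₂) (cong cv j₁≡j₂) same₁) same₂)
    where
    i₁≡i₂ : i₁ ≡ i₂
    i₁≡i₂ = position-injective (D.halve-odd-≋ (position i₁) (position i₂) p)
    j₁≡j₂ : j₁ ≡ j₂
    j₁≡j₂ = position-injective (A.≋-trans (CycSucc⇒≋suc ij₁)
              (A.≋-trans (A.≋-reflexive (cong (λ z → position z ℤ.+ + 1) i₁≡i₂)) (A.≋-sym (CycSucc⇒≋suc ij₂))))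
  point-≋⇒same {x = x} (on-cycle i _ _ _) (off-cycle _) p = ⊥-elim (D.odd≉even (position i) (position (root x)) p)
  point-≋⇒same {u} (off-cycle _) (on-cycle i _ _ _) p = ⊥-elim (D.odd≉even (position i) (position (root u)) (B.≋-sym p))
  point-≋⇒same {u} {x = x} (off-cycle uv) (off-cycle xy) p =
    inj₂ (proj₂ uv , proj₂ xy , _ ,
      (height-walk u ++ʷ subst (λ z → WalkIn (AdjOff C) (cv z) x (height x)) (sym same-root) (reverseʷ adjOff-sym (height-walk x))))
    where
    same-root : root u ≡ root x
    same-root = position-injective (D.halve-≋ _ _ p)

  module _ {i j k} (geo : GeodesicTriple C i j k) where

    double-≉ : ∀ {a b} → a ≢ b → ¬ (double a B.≋ double b)
    double-≉ a≢b p = a≢b (position-injective (D.halve-≋ _ _ p))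

    doubled-geodesic : B.dist (double i) (double j) ℕ.+ B.dist (double j) (double k) ℕ.+ B.dist (double i) (double k) ≡ m ℕ.+ m
    doubled-geodesic with proj₂ (proj₂ (proj₂ geo))
    ... | a , b , c , dij , djk , dik , sum = begin
      B.dist (double i) (double j) ℕ.+ B.dist (double j) (double k) ℕ.+ B.dist (double i) (double k)
        ≡⟨ cong₂ ℕ._+_ (cong₂ ℕ._+_ (D.dist-double (position i) (position j)) (D.dist-double (position j) (position k)))
                       (D.dist-double (position i) (position k)) ⟩
      (cycDist i j ℕ.+ cycDist i j) ℕ.+ (cycDist j k ℕ.+ cycDist j k) ℕ.+ (cycDist i k ℕ.+ cycDist i k)
        ≡⟨ regroup (cycDist i j) (cycDist j k) (cycDist i k) ⟩
      (cycDist i j ℕ.+ cycDist j k ℕ.+ cycDist i k) ℕ.+ (cycDist i j ℕ.+ cycDist j k ℕ.+ cycDist i k)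
        ≡⟨ cong (λ z → z ℕ.+ z) (trans (sym (cong₂ ℕ._+_ (cong₂ ℕ._+_ (onCycle dij) (onCycle djk)) (onCycle dik))) sum) ⟩
      m ℕ.+ m ∎
      where
      open ≡-Reasoning
      regroup : ∀ a b c → (a ℕ.+ a) ℕ.+ (b ℕ.+ b) ℕ.+ (c ℕ.+ c) ≡ (a ℕ.+ b ℕ.+ c) ℕ.+ (a ℕ.+ b ℕ.+ c)
      regroup = ℕSolver.solve-∀
      onCycle : ∀ {a b d} → Dist G (cv a) (cv b) d → d ≡ cycDist a b
      onCycle {a} {b} {d} p = trans (Dist⇒≡viaRoot b (cv a) d p) (viaRoot-cv b a)

    geodesic-triple-distinguishes : ∀ {u v x y} → Adj G u v → Adj G x y → ¬ SameEdge u v x y → ¬ SameComp C u v x y →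
      edgeDist i u v ≡ edgeDist i x y → edgeDist j u v ≡ edgeDist j x y → edgeDist k u v ≡ edgeDist k x y → ⊥
    geodesic-triple-distinguishes {u} {v} {x} {y} uv xy ¬same ¬comp ei ej ek =
      [ ¬same , ¬comp ]′ (point-≋⇒same κ₁ κ₂ (B.geodesic-triple-resolves _ _ _ _ _ _ _
        (double-≉ i≢j) (double-≉ j≢k) (double-≉ i≢k) doubled-geodesic (offset ei) (offset ej) (offset ek)))
      where
      i≢j : i ≢ j
      i≢j = proj₁ geo
      j≢k : j ≢ k
      j≢k = proj₁ (proj₂ geo)
      i≢k : i ≢ k
      i≢k = proj₁ (proj₂ (proj₂ geo))
      κ₁ : EdgeKind u v
      κ₁ = edgeKind uv
      κ₂ : EdgeKind x y
      κ₂ = edgeKind xy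
      rebalance : ∀ V c₁ c₂ K₁ K₂ D₁ D₂ → V ℕ.+ V ℕ.+ c₁ ≡ K₁ ℕ.+ D₁ → V ℕ.+ V ℕ.+ c₂ ≡ K₂ ℕ.+ D₂ →
                  (K₁ ℕ.+ c₂) ℕ.+ D₁ ≡ (K₂ ℕ.+ c₁) ℕ.+ D₂
      rebalance V c₁ c₂ K₁ K₂ D₁ D₂ e₁ e₂ =
        trans (swap K₁ c₂ D₁) (trans (cong (ℕ._+ c₂) (sym e₁)) (trans (swap′ V c₁ c₂) (trans (cong (ℕ._+ c₁) e₂) (sym (swap K₂ c₁ D₂)))))
        where
        swap : ∀ a b c → (a ℕ.+ b) ℕ.+ c ≡ (a ℕ.+ c) ℕ.+ b
        swap = ℕSolver.solve-∀
        swap′ : ∀ V a b → V ℕ.+ V ℕ.+ a ℕ.+ b ≡ V ℕ.+ V ℕ.+ b ℕ.+ a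
        swap′ = ℕSolver.solve-∀
      offset : ∀ {s} → edgeDist s u v ≡ edgeDist s x y →
               B.Offset (raise κ₁ ℕ.+ oddness κ₂) (point κ₁) (raise κ₂ ℕ.+ oddness κ₁) (point κ₂) (double s)
      offset {s} e = rebalance (edgeDist s u v) (oddness κ₁) (oddness κ₂) (raise κ₁) (raise κ₂) _ _ (edgeDist-doubled κ₁ s)
        (subst (λ z → z ℕ.+ z ℕ.+ oddness κ₂ ≡ raise κ₂ ℕ.+ B.dist (point κ₂) (double s)) (sym e) (edgeDist-doubled κ₂ s))

lemma5 : ∀ {n} (G : Graph n) (C : Cycle G) → UnicyclicWith G C →
    (i j k : Fin (len C)) → GeodesicTriple C i j k →
    (u v x y : Fin n) → Adj G u v → Adj G x y → ¬ SameEdge u v x y →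
    ¬ SameComp C u v x y →
    ∃ λ s → (s ≡ vert C i ⊎ s ≡ vert C j ⊎ s ≡ vert C k) ×
    (∀ a b → EdgeDist G u v s a → EdgeDist G x y s b → a ≢ b)
lemma5 G C uni i j k geo u v x y uv xy ¬same ¬comp = choose (compare i) (compare j) (compare k)
  where
  open EdgeCoordinates G C uni
  open DistanceFormula G C uni using (EdgeDist⇒≡viaRoot)
  Distinguishes : Fin (len C) → Set
  Distinguishes s = ∀ a b → EdgeDist G u v (vert C s) a → EdgeDist G x y (vert C s) b → a ≢ b
  Verdict : Fin (len C) → Set
  Verdict s = Distinguishes s ⊎ (edgeDist s u v ≡ edgeDist s x y)
  compare : ∀ s → Verdict s
  compare s with edgeDist s u v ℕ.≟ edgeDist s x y
  ... | yes e = inj₂ e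
  ... | no e≢ = inj₁ λ a b ea eb a≡b →
    e≢ (trans (sym (EdgeDist⇒≡viaRoot s u v a ea)) (trans a≡b (EdgeDist⇒≡viaRoot s x y b eb)))
  choose : Verdict i → Verdict j → Verdict k → ∃ λ s → (s ≡ vert C i ⊎ s ≡ vert C j ⊎ s ≡ vert C k) ×
             (∀ a b → EdgeDist G u v s a → EdgeDist G x y s b → a ≢ b)
  choose (inj₁ d) _ _ = vert C i , inj₁ refl , d
  choose _ (inj₁ d) _ = vert C j , inj₂ (inj₁ refl) , d
  choose _ _ (inj₁ d) = vert C k , inj₂ (inj₂ refl) , d
  choose (inj₂ ei) (inj₂ ej) (inj₂ ek) = ⊥-elim (geodesic-triple-distinguishes geo uv xy ¬same ¬comp ei ej ek)
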